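{- Let $(C_n)_{n\ge 0}$ be a sequence of rational numbers with $C_0=0$ satisfying, for all $n\ge 0$, $$4(n+4)C_{n+5}+8(n+2)C_{n+4}+(n+3)C_{n+3}+(4n+7)C_{n+2}+(5n+4)C_{n+1}+2n\,C_n=0.$$ Let $Q(x)=4+(x+x^2)^2$, let $y(x)\in\mathbb{Q}[[x]]$ be the power series square root of $Q(x)$ with $y(0)=2$, let $$\tilde R(x)=(4C_2-8C_1)+(8C_3+C_1)x+(12C_4+8C_3+2C_2+3C_1)x^2,$$ and let $\xi=\dfrac{\tilde R(x)}{2(1+2x)^2}\cdot\dfrac{dx}{y(x)}$. Then there is a constant $l$ (independent of $p$) such that for every prime $p$ for which the reduction of $\xi$ modulo $p$ is not exact in $\mathbb{F}_p[[x]]$, there exists $n\le l\,p$ such that $C_n$ is not $p$-integral.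
   Context: The form $\xi$ is a differential on the elliptic curve $y^2=Q(x)$ expanded at the point $(0,2)$. Its reduction modulo $p$ is exact in $\mathbb{F}_p[[x]]$ if the reduced coefficient series $g(x)\in\mathbb{F}_p((x))$ with $\xi=g(x)\,dx$ equals $h'(x)$ for some $h\in\mathbb{F}_p((x))$ (in particular its coefficients must be $p$-integral for this to make sense). -}

module Defs where

open import Data.Nat as ℕ using (ℕ; zero; suc)
open import Data.Nat.Divisibility using (_∣_)
open import Data.Integer as ℤ using (ℤ; +_; ∣_∣)
open import Data.Rational using (ℚ; _+_; _*_; _-_; _/_; 0ℚ; ↥_; ↧ₙ_)
open import Data.Product using (_×_; ∃)
open import Relation.Nullary using (¬_)
open import Relation.Binary.PropositionalEquality using (_≡_)

ℕ→ℚ : ℕ → ℚ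
ℕ→ℚ n = (+ n) / 1

ℤ→ℚ : ℤ → ℚ
ℤ→ℚ z = z / 1

Series : Set
Series = ℕ → ℚ

sumTo : ℕ → (ℕ → ℚ) → ℚ
sumTo zero    f = f 0
sumTo (suc n) f = sumTo n f + f (suc n)

cst : ℚ → Series
cst a zero    = a
cst a (suc _) = 0ℚ

X : Series
X 1 = ℕ→ℚ 1
X _ = 0ℚ

infixl 6 _⊕_
infixl 7 _⋆_

_⊕_ : Series → Series → Series
(f ⊕ g) n = f n + g n

_⋆_ : Series → Series → Series
(f ⋆ g) n = sumTo n (λ i → f i * g (n ℕ.∸ i))

-- p-adic notions for rationals (ℚ is kept in lowest terms)

PIntegral : ℕ → ℚ → Set
PIntegral p q = ¬ (p ∣ ↧ₙ q)

ZeroModP : ℕ → ℚ → Set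
ZeroModP p q = PIntegral p q × (p ∣ ∣ ↥ q ∣)

PIntegralSeries : ℕ → Series → Set
PIntegralSeries p g = (n : ℕ) → PIntegral p (g n)

-- the reduction mod p of g dx is exact: g ≡ h' mod p for some
-- h ∈ 𝔽_p[[x]], whose coefficients are represented by integer lifts
-- (coefficient of x^n in h' is (n+1) h_{n+1}).
ExactModP : ℕ → Series → Set
ExactModP p g =
  ∃ λ (h : ℕ → ℤ) → (n : ℕ) →
    ZeroModP p (g n - ℕ→ℚ (suc n) * ℤ→ℚ (h (suc n)))

Recurrence : (ℕ → ℚ) → ℕ → Set
Recurrence C n =
  ℕ→ℚ 4 * ℕ→ℚ (n ℕ.+ 4) * C (n ℕ.+ 5)
  + ℕ→ℚ 8 * ℕ→ℚ (n ℕ.+ 2) * C (n ℕ.+ 4)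
  + ℕ→ℚ (n ℕ.+ 3) * C (n ℕ.+ 3)
  + ℕ→ℚ (4 ℕ.* n ℕ.+ 7) * C (n ℕ.+ 2)
  + ℕ→ℚ (5 ℕ.* n ℕ.+ 4) * C (n ℕ.+ 1)
  + ℕ→ℚ (2 ℕ.* n) * C n
  ≡ 0ℚ

Qser : Series
Qser = cst (ℕ→ℚ 4) ⊕ (X ⊕ X ⋆ X) ⋆ (X ⊕ X ⋆ X)

Rt : (ℕ → ℚ) → Series
Rt C =
  cst (ℕ→ℚ 4 * C 2 - ℕ→ℚ 8 * C 1)
  ⊕ cst (ℕ→ℚ 8 * C 3 + C 1) ⋆ X
  ⊕ cst (ℕ→ℚ 12 * C 4 + ℕ→ℚ 8 * C 3 + ℕ→ℚ 2 * C 2 + ℕ→ℚ 3 * C 1) ⋆ X ⋆ X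

Den : Series → Series
Den y = cst (ℕ→ℚ 2) ⋆ (cst (ℕ→ℚ 1) ⊕ cst (ℕ→ℚ 2) ⋆ X)
                    ⋆ (cst (ℕ→ℚ 1) ⊕ cst (ℕ→ℚ 2) ⋆ X) ⋆ y

module Submission where

-- Let H = Σ Cₙ₊₁ xⁿ and G = H y / (1 + 2x). Multiplying out, the recurrence says exactly that
-- G′ (1 + 2x)² y = R̃, i.e. ξ = ½ dG.
--
-- For an odd prime p with C₀, …, C₃ₚ p-integral, G is p-integral up to x^(3p−1), so the coefficients
-- gₙ of ξ with p ∣ n + 1 < 3p are (n + 1) Gₙ₊₁ / 2 ≡ 0 (mod p). With T = (1 + 2x) y, the product
-- g Tᵖ = ½ R̃ (1 + 2x)ᵖ⁻² Q^((p−1)/2) is a polynomial of degree 3p − 2, while Tᵖ is p-integral with only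
-- monomials x^(jp) surviving mod p; comparing coefficients of xⁿ for n ≡ −1 (mod p) by induction gives
-- gₙ ≡ 0 for all such n. Every other gₙ is (n + 1) hₙ₊₁ mod p for a suitable hₙ₊₁, so ξ is exact.
--
-- For p = 2 nothing about C is needed: if g is 2-integral, k = (1 + 2x)² g satisfies 4 k² Q = R̃², and
-- after x ↦ 2x this reads σ² = κ² q with q = 1 + x² + 4x³ + 4x⁴ and κ, σ 2-integral. A 2-adic descent
-- shows that κ is divisible by every power of 2, so g = 0. Hence l = 3 works.

open import Defs
open import Data.Nat as ℕ using (ℕ)
open import Data.Nat.Primality using (Prime)
open import Data.Rational using (ℚ)
open import Relation.Binary.PropositionalEquality using (_≡_)

module RationalEmbedding where
  open import Data.Nat as ℕ using (ℕ; suc)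
  open import Data.Integer as ℤ using (ℤ; +_; ∣_∣)
  import Data.Integer.Properties as ℤ
  import Data.Integer.Tactic.RingSolver as ℤ-Solver
  open import Data.Rational hiding (∣_∣)
  open import Data.Rational.Properties
  import Data.Rational.Unnormalised as ℚᵘ
  import Data.Rational.Unnormalised.Properties as ℚᵘ
  open import Relation.Binary.PropositionalEquality
  open import Relation.Nullary.Decidable.Core using (dec⇒maybe)
  import Tactic.RingSolver as Solver
  import Tactic.RingSolver.Core.AlmostCommutativeRing as ACR
  open import Level using (0ℓ)

  ℚ-ring : ACR.AlmostCommutativeRing 0ℓ 0ℓ
  ℚ-ring = ACR.fromCommutativeRing +-*-commutativeRing (λ x → dec⇒maybe (0ℚ ≟ x))

  fromℚᵘ-homo-+ : ∀ p q → fromℚᵘ (p ℚᵘ.+ q) ≡ fromℚᵘ p + fromℚᵘ q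
  fromℚᵘ-homo-+ p q = toℚᵘ-injective (ℚᵘ.≃-trans (toℚᵘ-fromℚᵘ (p ℚᵘ.+ q))
    (ℚᵘ.≃-sym (ℚᵘ.≃-trans (toℚᵘ-homo-+ (fromℚᵘ p) (fromℚᵘ q))
                          (ℚᵘ.+-cong (toℚᵘ-fromℚᵘ p) (toℚᵘ-fromℚᵘ q)))))

  fromℚᵘ-homo-* : ∀ p q → fromℚᵘ (p ℚᵘ.* q) ≡ fromℚᵘ p * fromℚᵘ q
  fromℚᵘ-homo-* p q = toℚᵘ-injective (ℚᵘ.≃-trans (toℚᵘ-fromℚᵘ (p ℚᵘ.* q))
    (ℚᵘ.≃-sym (ℚᵘ.≃-trans (toℚᵘ-homo-* (fromℚᵘ p) (fromℚᵘ q))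
                          (ℚᵘ.*-cong (toℚᵘ-fromℚᵘ p) (toℚᵘ-fromℚᵘ q)))))

  fromℚᵘ-homo‿- : ∀ p → fromℚᵘ (ℚᵘ.- p) ≡ - fromℚᵘ p
  fromℚᵘ-homo‿- p = toℚᵘ-injective (ℚᵘ.≃-trans (toℚᵘ-fromℚᵘ (ℚᵘ.- p))
    (ℚᵘ.≃-sym (ℚᵘ.≃-trans (toℚᵘ-homo‿- (fromℚᵘ p)) (ℚᵘ.-‿cong (toℚᵘ-fromℚᵘ p)))))

  -- ℤ→ℚ a is definitionally fromℚᵘ (mkℚᵘ a 0).
  ℤ→ℚ-homo-+ : ∀ a b → ℤ→ℚ (a ℤ.+ b) ≡ ℤ→ℚ a + ℤ→ℚ b
  ℤ→ℚ-homo-+ a b = trans (fromℚᵘ-cong {ℚᵘ.mkℚᵘ (a ℤ.+ b) 0} {ℚᵘ.mkℚᵘ a 0 ℚᵘ.+ ℚᵘ.mkℚᵘ b 0}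
                           (ℚᵘ.*≡* (cross a b)))
                         (fromℚᵘ-homo-+ (ℚᵘ.mkℚᵘ a 0) (ℚᵘ.mkℚᵘ b 0))
    where
    cross : ∀ a b → (a ℤ.+ b) ℤ.* + 1 ≡ (a ℤ.* + 1 ℤ.+ b ℤ.* + 1) ℤ.* + 1
    cross = ℤ-Solver.solve-∀

  ℤ→ℚ-homo-* : ∀ a b → ℤ→ℚ (a ℤ.* b) ≡ ℤ→ℚ a * ℤ→ℚ b
  ℤ→ℚ-homo-* a b = fromℚᵘ-homo-* (ℚᵘ.mkℚᵘ a 0) (ℚᵘ.mkℚᵘ b 0)

  ℤ→ℚ-homo‿- : ∀ a → ℤ→ℚ (ℤ.- a) ≡ - ℤ→ℚ a
  ℤ→ℚ-homo‿- a = fromℚᵘ-homo‿- (ℚᵘ.mkℚᵘ a 0)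

  ℤ→ℚ-injective : ∀ {a b} → ℤ→ℚ a ≡ ℤ→ℚ b → a ≡ b
  ℤ→ℚ-injective {a} {b} eq
    with ℚᵘ.≃-trans (ℚᵘ.≃-sym (toℚᵘ-fromℚᵘ (ℚᵘ.mkℚᵘ a 0)))
                    (ℚᵘ.≃-trans (toℚᵘ-cong eq) (toℚᵘ-fromℚᵘ (ℚᵘ.mkℚᵘ b 0)))
  ... | ℚᵘ.*≡* a*1≡b*1 = trans (sym (ℤ.*-identityʳ a)) (trans a*1≡b*1 (ℤ.*-identityʳ b))

  ℕ→ℚ-homo-+ : ∀ m n → ℕ→ℚ (m ℕ.+ n) ≡ ℕ→ℚ m + ℕ→ℚ n
  ℕ→ℚ-homo-+ m n = trans (cong ℤ→ℚ (ℤ.pos-+ m n)) (ℤ→ℚ-homo-+ (+ m) (+ n))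

  ℕ→ℚ-homo-* : ∀ m n → ℕ→ℚ (m ℕ.* n) ≡ ℕ→ℚ m * ℕ→ℚ n
  ℕ→ℚ-homo-* m n = trans (cong ℤ→ℚ (ℤ.pos-* m n)) (ℤ→ℚ-homo-* (+ m) (+ n))

  *-↧≡↥ : ∀ q → q * ℕ→ℚ (↧ₙ q) ≡ ℤ→ℚ (↥ q)
  *-↧≡↥ q@(mkℚ n d-1 _) = begin
    q * ℕ→ℚ (suc d-1)                        ≡⟨ cong (_* ℕ→ℚ (suc d-1)) (sym (fromℚᵘ-toℚᵘ q)) ⟩
    fromℚᵘ (toℚᵘ q) * ℕ→ℚ (suc d-1)          ≡⟨ sym (fromℚᵘ-homo-* (toℚᵘ q) (ℚᵘ.mkℚᵘ (+ suc d-1) 0)) ⟩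
    fromℚᵘ (toℚᵘ q ℚᵘ.* ℚᵘ.mkℚᵘ (+ suc d-1) 0) ≡⟨ fromℚᵘ-cong {toℚᵘ q ℚᵘ.* _} {ℚᵘ.mkℚᵘ n 0} (ℚᵘ.*≡* (cross n (+ suc d-1))) ⟩
    ℤ→ℚ n                                    ∎
    where
    open ≡-Reasoning
    cross : ∀ n d → (n ℤ.* d) ℤ.* + 1 ≡ n ℤ.* (d ℤ.* + 1)
    cross = ℤ-Solver.solve-∀

  record Fraction (q : ℚ) : Set where
    constructor fraction
    field
      denom         : ℕ
      numer         : ℤ
      q*denom≡numer : q * ℕ→ℚ denom ≡ ℤ→ℚ numer

  open Fraction

  reduced : ∀ q → Fraction q
  reduced q = fraction (↧ₙ q) (↥ q) (*-↧≡↥ q)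

  Fraction-ℤ : ∀ i → Fraction (ℤ→ℚ i)
  Fraction-ℤ i = fraction 1 i (*-identityʳ (ℤ→ℚ i))

  Fraction-+ : ∀ {a b} → Fraction a → Fraction b → Fraction (a + b)
  Fraction-+ {a} {b} (fraction d i a*d≡i) (fraction e j b*e≡j) =
    fraction (d ℕ.* e) (i ℤ.* + e ℤ.+ j ℤ.* + d) (begin
      (a + b) * ℕ→ℚ (d ℕ.* e)                 ≡⟨ cong ((a + b) *_) (ℕ→ℚ-homo-* d e) ⟩
      (a + b) * (ℕ→ℚ d * ℕ→ℚ e)               ≡⟨ expand a b (ℕ→ℚ d) (ℕ→ℚ e) ⟩
      a * ℕ→ℚ d * ℕ→ℚ e + b * ℕ→ℚ e * ℕ→ℚ d   ≡⟨ cong₂ (λ u v → u * ℕ→ℚ e + v * ℕ→ℚ d) a*d≡i b*e≡j ⟩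
      ℤ→ℚ i * ℤ→ℚ (+ e) + ℤ→ℚ j * ℤ→ℚ (+ d)   ≡⟨ cong₂ _+_ (ℤ→ℚ-homo-* i (+ e)) (ℤ→ℚ-homo-* j (+ d)) ⟨
      ℤ→ℚ (i ℤ.* + e) + ℤ→ℚ (j ℤ.* + d)       ≡⟨ ℤ→ℚ-homo-+ (i ℤ.* + e) (j ℤ.* + d) ⟨
      ℤ→ℚ (i ℤ.* + e ℤ.+ j ℤ.* + d)           ∎)
    where
    open ≡-Reasoning
    expand : ∀ a b d e → (a + b) * (d * e) ≡ a * d * e + b * e * d
    expand = Solver.solve-∀ ℚ-ring

  Fraction-* : ∀ {a b} → Fraction a → Fraction b → Fraction (a * b)
  Fraction-* {a} {b} (fraction d i a*d≡i) (fraction e j b*e≡j) =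
    fraction (d ℕ.* e) (i ℤ.* j) (begin
      (a * b) * ℕ→ℚ (d ℕ.* e)       ≡⟨ cong ((a * b) *_) (ℕ→ℚ-homo-* d e) ⟩
      (a * b) * (ℕ→ℚ d * ℕ→ℚ e)     ≡⟨ regroup a b (ℕ→ℚ d) (ℕ→ℚ e) ⟩
      (a * ℕ→ℚ d) * (b * ℕ→ℚ e)     ≡⟨ cong₂ _*_ a*d≡i b*e≡j ⟩
      ℤ→ℚ i * ℤ→ℚ j                 ≡⟨ ℤ→ℚ-homo-* i j ⟨
      ℤ→ℚ (i ℤ.* j)                 ∎)
    where
    open ≡-Reasoning
    regroup : ∀ a b d e → (a * b) * (d * e) ≡ (a * d) * (b * e)
    regroup = Solver.solve-∀ ℚ-ring

  Fraction-neg : ∀ {a} → Fraction a → Fraction (- a)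
  Fraction-neg {a} (fraction d i a*d≡i) = fraction d (ℤ.- i)
    (trans (sym (neg-distribˡ-* a (ℕ→ℚ d))) (trans (cong -_ a*d≡i) (sym (ℤ→ℚ-homo‿- i))))

  ∣numer∣-agree : ∀ {q} (x y : Fraction q) → ∣ numer x ∣ ℕ.* denom y ≡ ∣ numer y ∣ ℕ.* denom x
  ∣numer∣-agree {q} x y = begin
    ∣ numer x ∣ ℕ.* denom y          ≡⟨ ℤ.abs-* (numer x) (+ denom y) ⟨
    ∣ numer x ℤ.* + denom y ∣        ≡⟨ cong ∣_∣ cross ⟩
    ∣ numer y ℤ.* + denom x ∣        ≡⟨ ℤ.abs-* (numer y) (+ denom x) ⟩
    ∣ numer y ∣ ℕ.* denom x          ∎
    where
    open ≡-Reasoning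
    swap : ∀ a b c → a * b * c ≡ a * c * b
    swap = Solver.solve-∀ ℚ-ring
    cross : numer x ℤ.* + denom y ≡ numer y ℤ.* + denom x
    cross = ℤ→ℚ-injective (begin
      ℤ→ℚ (numer x ℤ.* + denom y)        ≡⟨ ℤ→ℚ-homo-* (numer x) (+ denom y) ⟩
      ℤ→ℚ (numer x) * ℕ→ℚ (denom y)      ≡⟨ cong (_* ℕ→ℚ (denom y)) (sym (q*denom≡numer x)) ⟩
      q * ℕ→ℚ (denom x) * ℕ→ℚ (denom y)  ≡⟨ swap q (ℕ→ℚ (denom x)) (ℕ→ℚ (denom y)) ⟩
      q * ℕ→ℚ (denom y) * ℕ→ℚ (denom x)  ≡⟨ cong (_* ℕ→ℚ (denom x)) (q*denom≡numer y) ⟩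
      ℤ→ℚ (numer y) * ℕ→ℚ (denom x)      ≡⟨ ℤ→ℚ-homo-* (numer y) (+ denom x) ⟨
      ℤ→ℚ (numer y ℤ.* + denom x)        ∎)

module Integrality (p : ℕ) (p-prime : Prime p) where
  open RationalEmbedding
  open import Data.Nat as ℕ using (ℕ)
  import Data.Nat.Properties as ℕ
  open import Data.Nat.Divisibility as ℕ∣ using (_∣_)
  open import Data.Nat.Primality using (euclidsLemma; prime⇒irreducible; ¬prime[1])
  open import Data.Nat.GCD using (module Bézout)
  open import Data.Nat.Coprimality as Coprimality using (Coprime; coprime-Bézout)
  open import Data.Integer as ℤ using (ℤ; +_; ∣_∣)
  import Data.Integer.Properties as ℤ
  import Data.Integer.Divisibility.Signed as ℤ∣
  open import Data.Rational hiding (∣_∣)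
  open import Data.Rational.Properties
  open import Data.Product using (∃; _,_)
  open import Data.Sum using (inj₁; inj₂; [_,_]′)
  open import Data.Empty using (⊥-elim)
  open import Relation.Nullary using (¬_)
  open import Relation.Binary.PropositionalEquality
  import Tactic.RingSolver as Solver

  -- q ∈ ℤ₍ₚ₎, witnessed by any fraction for q whose denominator is prime to p; PIntegral insists on
  -- the reduced one.
  record Integral (q : ℚ) : Set where
    constructor integral
    field
      repr    : Fraction q
      p∤denom : ¬ p ∣ Fraction.denom repr

  record Vanishing (q : ℚ) : Set where
    constructor vanishing
    field
      isIntegral : Integral q
      p∣numer    : + p ℤ∣.∣ Fraction.numer (Integral.repr isIntegral)

  open Fraction

  p≢1 : ¬ p ≡ 1
  p≢1 refl = ¬prime[1] p-prime

  p∤1 : ¬ p ∣ 1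
  p∤1 p∣1 = p≢1 (ℕ∣.∣1⇒≡1 p∣1)

  p∤* : ∀ {m n} → ¬ p ∣ m → ¬ p ∣ n → ¬ p ∣ m ℕ.* n
  p∤* {m} {n} p∤m p∤n p∣mn with euclidsLemma m n p-prime p∣mn
  ... | inj₁ p∣m = p∤m p∣m
  ... | inj₂ p∣n = p∤n p∣n

  p∣*-cancelʳ : ∀ {m n} → p ∣ m ℕ.* n → ¬ p ∣ n → p ∣ m
  p∣*-cancelʳ {m} {n} p∣mn p∤n with euclidsLemma m n p-prime p∣mn
  ... | inj₁ p∣m = p∣m
  ... | inj₂ p∣n = ⊥-elim (p∤n p∣n)

  p∣square : ∀ {m} → p ∣ m ℕ.* m → p ∣ m
  p∣square {m} p∣mm with euclidsLemma m m p-prime p∣mm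
  ... | inj₁ p∣m = p∣m
  ... | inj₂ p∣m = p∣m

  p∤⇒coprime : ∀ {n} → ¬ p ∣ n → Coprime n p
  p∤⇒coprime p∤n (d∣n , d∣p) with prime⇒irreducible p-prime d∣p
  ... | inj₁ d≡1 = d≡1
  ... | inj₂ refl = ⊥-elim (p∤n d∣n)

  p∣↥⇒p∤↧ : ∀ q → p ∣ ∣ ↥ q ∣ → ¬ p ∣ ↧ₙ q
  p∣↥⇒p∤↧ (mkℚ _ _ coprime) p∣↥q p∣↧q = p≢1 (Coprimality.recompute coprime (p∣↥q , p∣↧q))

  Integral⇒PIntegral : ∀ {q} → Integral q → PIntegral p q
  Integral⇒PIntegral {q} (integral x p∤d) p∣↧q =
    [ (λ p∣↥q → p∣↥⇒p∤↧ q p∣↥q p∣↧q) , p∤d ]′ (euclidsLemma ∣ ↥ q ∣ (denom x) p-prime p∣↥q*d)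
    where
    p∣↥q*d : p ∣ ∣ ↥ q ∣ ℕ.* denom x
    p∣↥q*d = subst (p ∣_) (sym (∣numer∣-agree (reduced q) x)) (ℕ∣.∣n⇒∣m*n ∣ numer x ∣ p∣↧q)

  PIntegral⇒Integral : ∀ {q} → PIntegral p q → Integral q
  PIntegral⇒Integral {q} p∤↧q = integral (reduced q) p∤↧q

  vanishing-numer : ∀ {q} → Vanishing q → (x : Integral q) → p ∣ ∣ numer (Integral.repr x) ∣
  vanishing-numer (vanishing (integral y p∤e) p∣numer) (integral x _) =
    p∣*-cancelʳ (subst (p ∣_) (∣numer∣-agree y x) (ℕ∣.∣m⇒∣m*n (denom x) (ℤ∣.∣⇒∣ᵤ p∣numer))) p∤e

  Vanishing⇒ZeroModP : ∀ {q} → Vanishing q → ZeroModP p q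
  Vanishing⇒ZeroModP v@(vanishing x _) =
    Integral⇒PIntegral x , vanishing-numer v (PIntegral⇒Integral (Integral⇒PIntegral x))

  Integral-+ : ∀ {a b} → Integral a → Integral b → Integral (a + b)
  Integral-+ (integral x p∤d) (integral y p∤e) = integral (Fraction-+ x y) (p∤* p∤d p∤e)

  Integral-* : ∀ {a b} → Integral a → Integral b → Integral (a * b)
  Integral-* (integral x p∤d) (integral y p∤e) = integral (Fraction-* x y) (p∤* p∤d p∤e)

  Integral-neg : ∀ {a} → Integral a → Integral (- a)
  Integral-neg (integral x p∤d) = integral (Fraction-neg x) p∤d

  Integral-ℤ : ∀ i → Integral (ℤ→ℚ i)
  Integral-ℤ i = integral (Fraction-ℤ i) p∤1

  Integral-ℕ : ∀ n → Integral (ℕ→ℚ n)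
  Integral-ℕ n = Integral-ℤ (+ n)

  Vanishing-+ : ∀ {a b} → Vanishing a → Vanishing b → Vanishing (a + b)
  Vanishing-+ (vanishing x@(integral (fraction d _ _) _) p∣i) (vanishing y@(integral (fraction e _ _) _) p∣j) =
    vanishing (Integral-+ x y) (ℤ∣.∣m∣n⇒∣m+n (ℤ∣.∣m⇒∣m*n (+ e) p∣i) (ℤ∣.∣m⇒∣m*n (+ d) p∣j))

  Vanishing-*ʳ : ∀ {a b} → Vanishing a → Integral b → Vanishing (a * b)
  Vanishing-*ʳ (vanishing x@(integral (fraction _ _ _) _) p∣i) y@(integral (fraction _ j _) _) =
    vanishing (Integral-* x y) (ℤ∣.∣m⇒∣m*n j p∣i)

  Vanishing-*ˡ : ∀ {a b} → Integral a → Vanishing b → Vanishing (a * b)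
  Vanishing-*ˡ {a} {b} x v = subst Vanishing (*-comm b a) (Vanishing-*ʳ v x)

  Vanishing-neg : ∀ {a} → Vanishing a → Vanishing (- a)
  Vanishing-neg (vanishing x@(integral (fraction _ _ _) _) p∣i) = vanishing (Integral-neg x) (ℤ∣.∣m⇒∣-m p∣i)

  Vanishing-ℤ : ∀ {i} → + p ℤ∣.∣ i → Vanishing (ℤ→ℚ i)
  Vanishing-ℤ {i} p∣i = vanishing (Integral-ℤ i) p∣i

  Vanishing-p : Vanishing (ℕ→ℚ p)
  Vanishing-p = Vanishing-ℤ ℤ∣.∣-refl

  Vanishing-0 : Vanishing 0ℚ
  Vanishing-0 = Vanishing-ℤ {ℤ.+ 0} (ℤ∣.∣ᵤ⇒∣ (p ℕ∣.∣0))

  Vanishing-cancelˡ : ∀ {m x} → ¬ p ∣ m → Vanishing (ℕ→ℚ m * x) → Vanishing x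
  Vanishing-cancelˡ {m} {x} p∤m (vanishing (integral (fraction d i mx*d≡i) p∤d) p∣i) =
    vanishing (integral (fraction (m ℕ.* d) i x*md≡i) (p∤* p∤m p∤d)) p∣i
    where
    regroup : ∀ x m d → x * (m * d) ≡ m * x * d
    regroup = Solver.solve-∀ ℚ-ring
    x*md≡i : x * ℕ→ℚ (m ℕ.* d) ≡ ℤ→ℚ i
    x*md≡i = trans (cong (x *_) (ℕ→ℚ-homo-* m d)) (trans (regroup x (ℕ→ℚ m) (ℕ→ℚ d)) mx*d≡i)

  Vanishing-square : ∀ {x} → Integral x → Vanishing (x * x) → Vanishing x
  Vanishing-square x@(integral (fraction _ i _) _) v =
    vanishing x (ℤ∣.∣ᵤ⇒∣ (p∣square (subst (p ∣_) (ℤ.abs-* i i) (vanishing-numer v (Integral-* x x)))))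

  Integral-square : ∀ {x} → Integral (x * x) → Integral x
  Integral-square {x} (integral xx p∤d) = PIntegral⇒Integral p∤↧x
    where
    p∤↧x : ¬ p ∣ ↧ₙ x
    p∤↧x p∣↧x = p∣↥⇒p∤↧ x (p∣square (subst (p ∣_) (ℤ.abs-* (↥ x) (↥ x)) p∣↥x↥x)) p∣↧x
      where
      p∣↥x↥x : p ∣ ∣ ↥ x ℤ.* ↥ x ∣
      p∣↥x↥x = p∣*-cancelʳ
        (subst (p ∣_) (∣numer∣-agree xx (Fraction-* (reduced x) (reduced x)))
          (ℕ∣.∣n⇒∣m*n ∣ numer xx ∣ (ℕ∣.∣m⇒∣m*n (↧ₙ x) p∣↧x)))
        p∤d

  inverse-mod : ∀ {n} → ¬ p ∣ n → ∃ λ x → Vanishing (1ℚ - ℕ→ℚ n * ℤ→ℚ x)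
  inverse-mod {n} p∤n with coprime-Bézout (p∤⇒coprime p∤n)
  ... | Bézout.+- x y 1+yp≡xn =
    + x , subst Vanishing (sym 1-nx≡-yp) (Vanishing-neg (Vanishing-*ˡ (Integral-ℕ y) Vanishing-p))
    where
    open ≡-Reasoning
    1-nx≡-yp : 1ℚ - ℕ→ℚ n * ℕ→ℚ x ≡ - (ℕ→ℚ y * ℕ→ℚ p)
    1-nx≡-yp = begin
      1ℚ - ℕ→ℚ n * ℕ→ℚ x              ≡⟨ cong (λ t → 1ℚ - t) (ℕ→ℚ-homo-* n x) ⟨
      1ℚ - ℕ→ℚ (n ℕ.* x)              ≡⟨ cong (λ t → 1ℚ - ℕ→ℚ t) (trans (ℕ.*-comm n x) (sym 1+yp≡xn)) ⟩
      1ℚ - ℕ→ℚ (1 ℕ.+ y ℕ.* p)        ≡⟨ cong (λ t → 1ℚ - t) (ℕ→ℚ-homo-+ 1 (y ℕ.* p)) ⟩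
      1ℚ - (1ℚ + ℕ→ℚ (y ℕ.* p))       ≡⟨ cong (λ t → 1ℚ - (1ℚ + t)) (ℕ→ℚ-homo-* y p) ⟩
      1ℚ - (1ℚ + ℕ→ℚ y * ℕ→ℚ p)       ≡⟨ cancel (ℕ→ℚ y * ℕ→ℚ p) ⟩
      - (ℕ→ℚ y * ℕ→ℚ p)               ∎
      where
      cancel : ∀ t → 1ℚ - (1ℚ + t) ≡ - t
      cancel = Solver.solve-∀ ℚ-ring
  ... | Bézout.-+ x y 1+xn≡yp =
    ℤ.- + x , subst Vanishing (sym 1+nx≡yp) (Vanishing-*ˡ (Integral-ℕ y) Vanishing-p)
    where
    open ≡-Reasoning
    1+nx≡yp : 1ℚ - ℕ→ℚ n * ℤ→ℚ (ℤ.- + x) ≡ ℕ→ℚ y * ℕ→ℚ p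
    1+nx≡yp = begin
      1ℚ - ℕ→ℚ n * ℤ→ℚ (ℤ.- + x)      ≡⟨ cong (λ t → 1ℚ - ℕ→ℚ n * t) (ℤ→ℚ-homo‿- (+ x)) ⟩
      1ℚ - ℕ→ℚ n * - ℕ→ℚ x            ≡⟨ flip (ℕ→ℚ n) (ℕ→ℚ x) ⟩
      1ℚ + ℕ→ℚ x * ℕ→ℚ n              ≡⟨ cong (λ t → 1ℚ + t) (ℕ→ℚ-homo-* x n) ⟨
      1ℚ + ℕ→ℚ (x ℕ.* n)              ≡⟨ ℕ→ℚ-homo-+ 1 (x ℕ.* n) ⟨
      ℕ→ℚ (1 ℕ.+ x ℕ.* n)             ≡⟨ cong ℕ→ℚ 1+xn≡yp ⟩
      ℕ→ℚ (y ℕ.* p)                   ≡⟨ ℕ→ℚ-homo-* y p ⟩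
      ℕ→ℚ y * ℕ→ℚ p                   ∎
      where
      flip : ∀ n x → 1ℚ - n * - x ≡ 1ℚ + x * n
      flip = Solver.solve-∀ ℚ-ring

  lift-mod : ∀ {q m} → Integral q → ¬ p ∣ m → ∃ λ z → Vanishing (q - ℕ→ℚ m * ℤ→ℚ z)
  lift-mod {q} {m} x@(integral (fraction d i q*d≡i) p∤d) p∤m
    with inverse-mod (p∤* p∤m p∤d)
  ... | u , 1-mdu≡0 = i ℤ.* u , subst Vanishing (sym q-mz≡q[1-mdu]) (Vanishing-*ˡ x 1-mdu≡0)
    where
    open ≡-Reasoning
    q-mz≡q[1-mdu] : q - ℕ→ℚ m * ℤ→ℚ (i ℤ.* u) ≡ q * (1ℚ - ℕ→ℚ (m ℕ.* d) * ℤ→ℚ u)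
    q-mz≡q[1-mdu] = begin
      q - ℕ→ℚ m * ℤ→ℚ (i ℤ.* u)                  ≡⟨ cong (λ t → q - ℕ→ℚ m * t) (ℤ→ℚ-homo-* i u) ⟩
      q - ℕ→ℚ m * (ℤ→ℚ i * ℤ→ℚ u)                ≡⟨ cong (λ t → q - ℕ→ℚ m * (t * ℤ→ℚ u)) (sym q*d≡i) ⟩
      q - ℕ→ℚ m * (q * ℕ→ℚ d * ℤ→ℚ u)            ≡⟨ factor q (ℕ→ℚ m) (ℕ→ℚ d) (ℤ→ℚ u) ⟩
      q * (1ℚ - ℕ→ℚ m * ℕ→ℚ d * ℤ→ℚ u)           ≡⟨ cong (λ t → q * (1ℚ - t * ℤ→ℚ u)) (ℕ→ℚ-homo-* m d) ⟨
      q * (1ℚ - ℕ→ℚ (m ℕ.* d) * ℤ→ℚ u)           ∎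
      where
      factor : ∀ q m d u → q - m * (q * d * u) ≡ q * (1ℚ - m * d * u)
      factor = Solver.solve-∀ ℚ-ring

module FiniteSums where
  open RationalEmbedding using (ℚ-ring)
  open import Data.Nat as ℕ using (ℕ; zero; suc; _≤_; _∸_; z≤n)
  import Data.Nat.Properties as ℕ
  open import Data.Rational hiding (_≤_)
  open import Data.Rational.Properties
  open import Relation.Binary.PropositionalEquality
  import Tactic.RingSolver as Solver

  sumTo-cong : ∀ n {f g : ℕ → ℚ} → (∀ i → i ≤ n → f i ≡ g i) → sumTo n f ≡ sumTo n g
  sumTo-cong zero    f≡g = f≡g 0 z≤n
  sumTo-cong (suc n) f≡g =
    cong₂ _+_ (sumTo-cong n (λ i i≤n → f≡g i (ℕ.m≤n⇒m≤1+n i≤n))) (f≡g (suc n) ℕ.≤-refl)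

  sumTo-+ : ∀ n (f g : ℕ → ℚ) → sumTo n (λ i → f i + g i) ≡ sumTo n f + sumTo n g
  sumTo-+ zero    f g = refl
  sumTo-+ (suc n) f g = trans (cong (_+ (f (suc n) + g (suc n))) (sumTo-+ n f g))
                              (interchange (sumTo n f) (sumTo n g) (f (suc n)) (g (suc n)))
    where
    interchange : ∀ a b c d → (a + b) + (c + d) ≡ (a + c) + (b + d)
    interchange = Solver.solve-∀ ℚ-ring

  sumTo-*ˡ : ∀ n a (f : ℕ → ℚ) → a * sumTo n f ≡ sumTo n (λ i → a * f i)
  sumTo-*ˡ zero    a f = refl
  sumTo-*ˡ (suc n) a f = trans (*-distribˡ-+ a (sumTo n f) (f (suc n)))
                               (cong (_+ a * f (suc n)) (sumTo-*ˡ n a f))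

  sumTo-*ʳ : ∀ n a (f : ℕ → ℚ) → sumTo n f * a ≡ sumTo n (λ i → f i * a)
  sumTo-*ʳ n a f = trans (*-comm (sumTo n f) a)
                         (trans (sumTo-*ˡ n a f) (sumTo-cong n (λ i _ → *-comm a (f i))))

  sumTo-zero : ∀ n {f : ℕ → ℚ} → (∀ i → i ≤ n → f i ≡ 0ℚ) → sumTo n f ≡ 0ℚ
  sumTo-zero zero    f≡0 = f≡0 0 z≤n
  sumTo-zero (suc n) f≡0 =
    cong₂ _+_ (sumTo-zero n (λ i i≤n → f≡0 i (ℕ.m≤n⇒m≤1+n i≤n))) (f≡0 (suc n) ℕ.≤-refl)

  sumTo-head : ∀ n (f : ℕ → ℚ) → sumTo (suc n) f ≡ f 0 + sumTo n (λ i → f (suc i))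
  sumTo-head zero    f = refl
  sumTo-head (suc n) f = trans (cong (_+ f (suc (suc n))) (sumTo-head n f))
                               (+-assoc (f 0) (sumTo n (λ i → f (suc i))) (f (suc (suc n))))

  sumTo-reverse : ∀ n (f : ℕ → ℚ) → sumTo n f ≡ sumTo n (λ i → f (n ∸ i))
  sumTo-reverse zero    f = refl
  sumTo-reverse (suc n) f = trans (cong (_+ f (suc n)) (sumTo-reverse n f))
    (trans (+-comm (sumTo n (λ i → f (n ∸ i))) (f (suc n)))
           (sym (sumTo-head n (λ i → f (suc n ∸ i)))))

  sumTo-triangle : ∀ n (F : ℕ → ℕ → ℚ) →
    sumTo n (λ i → sumTo i (F i)) ≡ sumTo n (λ j → sumTo (n ∸ j) (λ k → F (j ℕ.+ k) j))
  sumTo-triangle zero    F = refl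
  sumTo-triangle (suc n) F = begin
    sumTo n (λ i → sumTo i (F i)) + sumTo (suc n) (F (suc n))
      ≡⟨ cong (_+ sumTo (suc n) (F (suc n))) (sumTo-triangle n F) ⟩
    Rows n + (sumTo n (F (suc n)) + F (suc n) (suc n))
      ≡⟨ +-assoc (Rows n) (sumTo n (F (suc n))) (F (suc n) (suc n)) ⟨
    (Rows n + sumTo n (F (suc n))) + F (suc n) (suc n)
      ≡⟨ cong (_+ F (suc n) (suc n)) (sumTo-+ n _ _) ⟨
    sumTo n (λ j → sumTo (n ∸ j) (λ k → F (j ℕ.+ k) j) + F (suc n) j) + F (suc n) (suc n)
      ≡⟨ cong₂ _+_ (sumTo-cong n extend) (cong (λ m → F m (suc n)) (sym (ℕ.+-identityʳ (suc n)))) ⟩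
    sumTo n (λ j → sumTo (suc n ∸ j) (λ k → F (j ℕ.+ k) j)) + F (suc n ℕ.+ 0) (suc n)
      ≡⟨ cong (λ m → sumTo n (λ j → sumTo (suc n ∸ j) (λ k → F (j ℕ.+ k) j))
                      + sumTo m (λ k → F (suc n ℕ.+ k) (suc n))) (sym (ℕ.n∸n≡0 n)) ⟩
    sumTo n (λ j → sumTo (suc n ∸ j) (λ k → F (j ℕ.+ k) j)) + sumTo (n ∸ n) (λ k → F (suc n ℕ.+ k) (suc n)) ∎
    where
    open ≡-Reasoning
    Rows : ℕ → ℚ
    Rows n = sumTo n (λ j → sumTo (n ∸ j) (λ k → F (j ℕ.+ k) j))
    extend : ∀ j → j ≤ n →
             sumTo (n ∸ j) (λ k → F (j ℕ.+ k) j) + F (suc n) j ≡ sumTo (suc n ∸ j) (λ k → F (j ℕ.+ k) j)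
    extend j j≤n rewrite ℕ.+-∸-assoc 1 j≤n =
      cong (λ m → sumTo (n ∸ j) (λ k → F (j ℕ.+ k) j) + F m j)
        (trans (cong suc (sym (ℕ.m+[n∸m]≡n j≤n))) (sym (ℕ.+-suc j (n ∸ j))))

module PowerSeries where
  open RationalEmbedding
  open FiniteSums
  open import Data.Nat as ℕ using (ℕ; zero; suc; _≤_; _<_; _∸_; s≤s)
  import Data.Nat.Properties as ℕ
  open import Data.Rational hiding (_≤_; _<_)
  open import Data.Rational.Properties
  open import Data.List using (List; []; _∷_)
  open import Data.Maybe using (Maybe; just; nothing)
  open import Data.Product using (_,_)
  open import Data.Nat.Induction using (<-rec)
  open import Relation.Nullary using (yes; no)
  open import Relation.Binary.PropositionalEquality
  open import Algebra.Bundles using (CommutativeRing)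
  import Algebra.Solver.Ring
  import Algebra.Solver.Ring.AlmostCommutativeRing as ACR
  import Tactic.RingSolver as Solver
  open import Level using (0ℓ)

  infix 4 _≋_
  record _≋_ (f g : Series) : Set where
    constructor pointwise
    field at : ∀ n → f n ≡ g n
  open _≋_ public

  0ₛ : Series
  0ₛ _ = 0ℚ

  1ₛ : Series
  1ₛ = cst 1ℚ

  -ₛ_ : Series → Series
  (-ₛ f) n = - f n

  ⋆-cong : ∀ {f f′ g g′} → f ≋ f′ → g ≋ g′ → f ⋆ g ≋ f′ ⋆ g′
  ⋆-cong f≋f′ g≋g′ = pointwise λ n → sumTo-cong n (λ i _ → cong₂ _*_ (at f≋f′ i) (at g≋g′ (n ∸ i)))

  ⋆-comm : ∀ f g → f ⋆ g ≋ g ⋆ f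
  ⋆-comm f g = pointwise λ n → trans (sumTo-reverse n _) (sumTo-cong n (λ i i≤n →
    trans (cong (λ m → f (n ∸ i) * g m) (ℕ.m∸[m∸n]≡n i≤n)) (*-comm (f (n ∸ i)) (g i))))

  ⋆-assoc : ∀ f g h → (f ⋆ g) ⋆ h ≋ f ⋆ (g ⋆ h)
  ⋆-assoc f g h = pointwise λ n → begin
    sumTo n (λ i → sumTo i (λ j → f j * g (i ∸ j)) * h (n ∸ i))
      ≡⟨ sumTo-cong n (λ i _ → sumTo-*ʳ i (h (n ∸ i)) (λ j → f j * g (i ∸ j))) ⟩
    sumTo n (λ i → sumTo i (λ j → f j * g (i ∸ j) * h (n ∸ i)))
      ≡⟨ sumTo-triangle n (λ i j → f j * g (i ∸ j) * h (n ∸ i)) ⟩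
    sumTo n (λ j → sumTo (n ∸ j) (λ k → f j * g ((j ℕ.+ k) ∸ j) * h (n ∸ (j ℕ.+ k))))
      ≡⟨ sumTo-cong n (λ j _ → sumTo-cong (n ∸ j) (λ k _ →
           trans (cong₂ (λ a b → f j * g a * h b) (ℕ.m+n∸m≡n j k) (sym (ℕ.∸-+-assoc n j k)))
                 (*-assoc (f j) (g k) (h ((n ∸ j) ∸ k))))) ⟩
    sumTo n (λ j → sumTo (n ∸ j) (λ k → f j * (g k * h ((n ∸ j) ∸ k))))
      ≡⟨ sumTo-cong n (λ j _ → sumTo-*ˡ (n ∸ j) (f j) (λ k → g k * h ((n ∸ j) ∸ k))) ⟨
    sumTo n (λ j → f j * sumTo (n ∸ j) (λ k → g k * h ((n ∸ j) ∸ k))) ∎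
    where open ≡-Reasoning

  ⋆-distribʳ : ∀ h f g → (f ⊕ g) ⋆ h ≋ f ⋆ h ⊕ g ⋆ h
  ⋆-distribʳ h f g = pointwise λ n →
    trans (sumTo-cong n (λ i _ → *-distribʳ-+ (h (n ∸ i)) (f i) (g i))) (sumTo-+ n _ _)

  ⋆-distribˡ : ∀ h f g → h ⋆ (f ⊕ g) ≋ h ⋆ f ⊕ h ⋆ g
  ⋆-distribˡ h f g = pointwise λ n →
    trans (sumTo-cong n (λ i _ → *-distribˡ-+ (h i) (f (n ∸ i)) (g (n ∸ i)))) (sumTo-+ n _ _)

  cst-⋆ : ∀ a f n → (cst a ⋆ f) n ≡ a * f n
  cst-⋆ a f zero    = refl
  cst-⋆ a f (suc n) = trans (sumTo-head n _)
    (trans (cong (a * f (suc n) +_) (sumTo-zero n (λ i _ → *-zeroˡ (f (n ∸ i)))))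
           (+-identityʳ (a * f (suc n))))

  X-⋆-zero : ∀ f → (X ⋆ f) 0 ≡ 0ℚ
  X-⋆-zero f = *-zeroˡ (f 0)

  X-⋆-suc : ∀ f n → (X ⋆ f) (suc n) ≡ f n
  X-⋆-suc f n = begin
    (X ⋆ f) (suc n)                                         ≡⟨ sumTo-head n _ ⟩
    0ℚ * f (suc n) + sumTo n (λ i → X (suc i) * f (n ∸ i))  ≡⟨ cong₂ _+_ (*-zeroˡ (f (suc n))) (shifted n) ⟩
    0ℚ + f n                                                ≡⟨ +-identityˡ (f n) ⟩
    f n                                                     ∎
    where
    open ≡-Reasoning
    shifted : ∀ m → sumTo m (λ i → X (suc i) * f (m ∸ i)) ≡ f m
    shifted zero    = *-identityˡ (f 0)
    shifted (suc m) = trans (sumTo-head m _)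
      (trans (cong₂ _+_ (*-identityˡ (f (suc m))) (sumTo-zero m (λ i _ → *-zeroˡ (f (m ∸ i)))))
             (+-identityʳ (f (suc m))))

  seriesRing : CommutativeRing 0ℓ 0ℓ
  seriesRing = record
    { Carrier = Series ; _≈_ = _≋_ ; _+_ = _⊕_ ; _*_ = _⋆_ ; -_ = -ₛ_ ; 0# = 0ₛ ; 1# = 1ₛ
    ; isCommutativeRing = record
      { isRing = record
        { +-isAbelianGroup = record
          { isGroup = record
            { isMonoid = record
              { isSemigroup = record
                { isMagma = record
                  { isEquivalence = record
                    { refl  = pointwise λ _ → refl
                    ; sym   = λ f≋g → pointwise λ n → sym (at f≋g n)
                    ; trans = λ f≋g g≋h → pointwise λ n → trans (at f≋g n) (at g≋h n) }
                  ; ∙-cong = λ f≋f′ g≋g′ → pointwise λ n → cong₂ _+_ (at f≋f′ n) (at g≋g′ n) }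
                ; assoc = λ f g h → pointwise λ n → +-assoc (f n) (g n) (h n) }
              ; identity = (λ f → pointwise λ n → +-identityˡ (f n))
                         , (λ f → pointwise λ n → +-identityʳ (f n)) }
            ; inverse = (λ f → pointwise λ n → +-inverseˡ (f n))
                      , (λ f → pointwise λ n → +-inverseʳ (f n))
            ; ⁻¹-cong = λ f≋g → pointwise λ n → cong -_ (at f≋g n) }
          ; comm = λ f g → pointwise λ n → +-comm (f n) (g n) }
        ; *-cong = ⋆-cong
        ; *-assoc = ⋆-assoc
        ; *-identity = ⋆-identityˡ , λ f → S-trans (⋆-comm f 1ₛ) (⋆-identityˡ f)
        ; distrib = ⋆-distribˡ , ⋆-distribʳ }
      ; *-comm = ⋆-comm } }
    where
    ⋆-identityˡ : ∀ f → 1ₛ ⋆ f ≋ f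
    ⋆-identityˡ f = pointwise λ n → trans (cst-⋆ 1ℚ f n) (*-identityˡ (f n))
    S-trans : ∀ {f g h} → f ≋ g → g ≋ h → f ≋ h
    S-trans f≋g g≋h = pointwise λ n → trans (at f≋g n) (at g≋h n)

  module S = CommutativeRing seriesRing

  cst-+ : ∀ a b → cst (a + b) ≋ cst a ⊕ cst b
  cst-+ a b = pointwise λ { zero → refl ; (suc n) → sym (+-identityʳ 0ℚ) }

  cst-* : ∀ a b → cst (a * b) ≋ cst a ⋆ cst b
  cst-* a b = pointwise λ { zero → refl ; (suc n) → sym (trans (cst-⋆ a (cst b) (suc n)) (*-zeroʳ a)) }

  cst-homomorphism : CommutativeRing.rawRing +-*-commutativeRing
                       ACR.-Raw-AlmostCommutative⟶ ACR.fromCommutativeRing seriesRing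
  cst-homomorphism = record
    { ⟦_⟧    = cst
    ; +-homo = cst-+
    ; *-homo = cst-*
    ; -‿homo = λ a → pointwise λ { zero → refl ; (suc n) → refl }
    ; 0-homo = pointwise λ { zero → refl ; (suc n) → refl }
    ; 1-homo = pointwise λ _ → refl }

  cst-≟ : ∀ a b → Maybe (cst a ≋ cst b)
  cst-≟ a b with a ≟ b
  ... | yes refl = just S.refl
  ... | no _     = nothing

  module SeriesSolver where
    open Algebra.Solver.Ring (CommutativeRing.rawRing +-*-commutativeRing)
                             (ACR.fromCommutativeRing seriesRing) cst-homomorphism cst-≟ public
      using (Polynomial; solve; con; _:+_; _:*_; _:-_; _:=_)

  open import Algebra.Properties.CommutativeSemiring.Exp S.commutativeSemiring public
    using (_^_; ^-congˡ; ^-congʳ; ^-homo-*; ^-distrib-*)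

  ∂ : Series → Series
  ∂ f n = ℕ→ℚ (suc n) * f (suc n)

  ∂-cong : ∀ {f g} → f ≋ g → ∂ f ≋ ∂ g
  ∂-cong f≋g = pointwise λ n → cong (ℕ→ℚ (suc n) *_) (at f≋g (suc n))

  ∂-⊕ : ∀ f g → ∂ (f ⊕ g) ≋ ∂ f ⊕ ∂ g
  ∂-⊕ f g = pointwise λ n → *-distribˡ-+ (ℕ→ℚ (suc n)) (f (suc n)) (g (suc n))

  ∂-cst : ∀ a → ∂ (cst a) ≋ 0ₛ
  ∂-cst a = pointwise λ n → *-zeroʳ (ℕ→ℚ (suc n))

  ∂-X : ∂ X ≋ 1ₛ
  ∂-X = pointwise λ { zero → refl ; (suc n) → *-zeroʳ (ℕ→ℚ (suc (suc n))) }

  -- Split the weight n + 1 of the i-th term of the product as i + (n + 1 − i).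
  ∂-⋆ : ∀ f g → ∂ (f ⋆ g) ≋ ∂ f ⋆ g ⊕ f ⋆ ∂ g
  ∂-⋆ f g = pointwise leibniz
    where
    open ≡-Reasoning
    split : ∀ m i → i ≤ m → ℕ→ℚ m ≡ ℕ→ℚ i + ℕ→ℚ (m ∸ i)
    split m i i≤m = trans (cong ℕ→ℚ (sym (ℕ.m+[n∸m]≡n i≤m))) (ℕ→ℚ-homo-+ i (m ∸ i))
    left : ∀ n → sumTo (suc n) (λ i → ℕ→ℚ i * (f i * g (suc n ∸ i))) ≡ (∂ f ⋆ g) n
    left n = trans (sumTo-head n _)
      (trans (cong (_+ sumTo n (λ i → ℕ→ℚ (suc i) * (f (suc i) * g (n ∸ i)))) (*-zeroˡ (f 0 * g (suc n))))
      (trans (+-identityˡ _)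
             (sumTo-cong n (λ i _ → sym (*-assoc (ℕ→ℚ (suc i)) (f (suc i)) (g (n ∸ i)))))))
    swap : ∀ a b c → a * (b * c) ≡ b * (a * c)
    swap = Solver.solve-∀ ℚ-ring
    right : ∀ n → sumTo (suc n) (λ i → ℕ→ℚ (suc n ∸ i) * (f i * g (suc n ∸ i))) ≡ (f ⋆ ∂ g) n
    right n = begin
      sumTo n F + F (suc n)   ≡⟨ cong (sumTo n F +_) last ⟩
      sumTo n F + 0ℚ          ≡⟨ +-identityʳ (sumTo n F) ⟩
      sumTo n F               ≡⟨ sumTo-cong n shift ⟩
      (f ⋆ ∂ g) n             ∎
      where
      F : ℕ → ℚ
      F i = ℕ→ℚ (suc n ∸ i) * (f i * g (suc n ∸ i))
      last : F (suc n) ≡ 0ℚ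
      last = trans (cong (λ m → ℕ→ℚ m * (f (suc n) * g m)) (ℕ.n∸n≡0 n)) (*-zeroˡ (f (suc n) * g 0))
      shift : ∀ i → i ≤ n → F i ≡ f i * ∂ g (n ∸ i)
      shift i i≤n = trans (cong (λ m → ℕ→ℚ m * (f i * g m)) (ℕ.+-∸-assoc 1 i≤n))
                          (swap (ℕ→ℚ (suc (n ∸ i))) (f i) (g (suc (n ∸ i))))
    leibniz : ∀ n → ∂ (f ⋆ g) n ≡ (∂ f ⋆ g ⊕ f ⋆ ∂ g) n
    leibniz n = begin
      ℕ→ℚ (suc n) * sumTo (suc n) T
        ≡⟨ sumTo-*ˡ (suc n) (ℕ→ℚ (suc n)) T ⟩
      sumTo (suc n) (λ i → ℕ→ℚ (suc n) * T i)
        ≡⟨ sumTo-cong (suc n) (λ i i≤ → trans (cong (_* T i) (split (suc n) i i≤))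
                                              (*-distribʳ-+ (T i) (ℕ→ℚ i) (ℕ→ℚ (suc n ∸ i)))) ⟩
      sumTo (suc n) (λ i → ℕ→ℚ i * T i + ℕ→ℚ (suc n ∸ i) * T i)
        ≡⟨ sumTo-+ (suc n) _ _ ⟩
      sumTo (suc n) (λ i → ℕ→ℚ i * T i) + sumTo (suc n) (λ i → ℕ→ℚ (suc n ∸ i) * T i)
        ≡⟨ cong₂ _+_ (left n) (right n) ⟩
      (∂ f ⋆ g) n + (f ⋆ ∂ g) n ∎
      where
      T : ℕ → ℚ
      T i = f i * g (suc n ∸ i)

  ∂-^ : ∀ f n → ∂ (f ^ suc n) ≋ cst (ℕ→ℚ (suc n)) ⋆ (f ^ n ⋆ ∂ f)
  ∂-^ f zero = begin
    ∂ (f ⋆ 1ₛ)           ≈⟨ ∂-cong (S.*-identityʳ f) ⟩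
    ∂ f                  ≈⟨ S.*-identityˡ (∂ f) ⟨
    1ₛ ⋆ ∂ f             ≈⟨ S.*-identityˡ (1ₛ ⋆ ∂ f) ⟨
    1ₛ ⋆ (1ₛ ⋆ ∂ f)      ∎
    where open import Relation.Binary.Reasoning.Setoid S.setoid
  ∂-^ f (suc n) = begin
    ∂ (f ⋆ f ^ suc n)                                          ≈⟨ ∂-⋆ f (f ^ suc n) ⟩
    ∂ f ⋆ f ^ suc n ⊕ f ⋆ ∂ (f ^ suc n)                        ≈⟨ S.+-congˡ {∂ f ⋆ f ^ suc n} (S.*-congˡ {f} (∂-^ f n)) ⟩
    ∂ f ⋆ f ^ suc n ⊕ f ⋆ (cst (ℕ→ℚ (suc n)) ⋆ (f ^ n ⋆ ∂ f))   ≈⟨ S.refl ⟩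
    ∂ f ⋆ (f ⋆ f ^ n) ⊕ f ⋆ (cst (ℕ→ℚ (suc n)) ⋆ (f ^ n ⋆ ∂ f))
      ≈⟨ solve 4 (λ f a d c → d :* (f :* a) :+ f :* (c :* (a :* d)) := (con 1ℚ :+ c) :* ((f :* a) :* d))
               S.refl f (f ^ n) (∂ f) (cst (ℕ→ℚ (suc n))) ⟩
    (1ₛ ⊕ cst (ℕ→ℚ (suc n))) ⋆ ((f ⋆ f ^ n) ⋆ ∂ f)
      ≈⟨ S.*-congʳ {(f ⋆ f ^ n) ⋆ ∂ f} (S.trans (S.sym (cst-+ 1ℚ (ℕ→ℚ (suc n))))
                            (pointwise λ m → cong (λ c → cst c m) (sym (ℕ→ℚ-homo-+ 1 (suc n))))) ⟩
    cst (ℕ→ℚ (suc (suc n))) ⋆ (f ^ suc n ⋆ ∂ f)                ∎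
    where
    open import Relation.Binary.Reasoning.Setoid S.setoid
    open SeriesSolver

  ⋆-cancel-zero : ∀ {c d e} → e * d 0 ≡ 1ℚ → c ⋆ d ≋ 0ₛ → c ≋ 0ₛ
  ⋆-cancel-zero {c} {d} {e} e*d₀≡1 c⋆d≋0 = pointwise (<-rec (λ n → c n ≡ 0ℚ) step)
    where
    open ≡-Reasoning
    d₀-cancel : ∀ {x} → d 0 * x ≡ 0ℚ → x ≡ 0ℚ
    d₀-cancel {x} d₀x≡0 = begin
      x                ≡⟨ *-identityˡ x ⟨
      1ℚ * x           ≡⟨ cong (_* x) e*d₀≡1 ⟨
      e * d 0 * x      ≡⟨ *-assoc e (d 0) x ⟩
      e * (d 0 * x)    ≡⟨ cong (e *_) d₀x≡0 ⟩
      e * 0ℚ           ≡⟨ *-zeroʳ e ⟩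
      0ℚ               ∎
    step : ∀ n → (∀ {m} → m < n → c m ≡ 0ℚ) → c n ≡ 0ℚ
    step zero    _  = d₀-cancel (trans (*-comm (d 0) (c 0)) (at c⋆d≋0 0))
    step (suc n) ih = d₀-cancel (begin
      d 0 * c (suc n)                                          ≡⟨ +-identityʳ _ ⟨
      d 0 * c (suc n) + 0ℚ                                     ≡⟨ cong (d 0 * c (suc n) +_) lower-terms ⟨
      d 0 * c (suc n) + sumTo n (λ i → d (suc i) * c (n ∸ i))  ≡⟨ sumTo-head n _ ⟨
      (d ⋆ c) (suc n)                                          ≡⟨ at (⋆-comm d c) (suc n) ⟩
      (c ⋆ d) (suc n)                                          ≡⟨ at c⋆d≋0 (suc n) ⟩
      0ℚ                                                       ∎)
      where
      lower-terms : sumTo n (λ i → d (suc i) * c (n ∸ i)) ≡ 0ℚ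
      lower-terms = sumTo-zero n (λ i _ →
        trans (cong (d (suc i) *_) (ih (s≤s (ℕ.m∸n≤m n i)))) (*-zeroʳ (d (suc i))))

  ⋆-cancelʳ : ∀ {a b d e} → e * d 0 ≡ 1ℚ → a ⋆ d ≋ b ⋆ d → a ≋ b
  ⋆-cancelʳ {a} {b} {d} {e} e*d₀≡1 a⋆d≋b⋆d = begin
    a                    ≈⟨ solve 2 (λ a b → a := (a :- b) :+ b) S.refl a b ⟩
    (a ⊕ -ₛ b) ⊕ b       ≈⟨ S.+-congʳ {b} (⋆-cancel-zero {a ⊕ -ₛ b} {d} {e} e*d₀≡1 difference) ⟩
    0ₛ ⊕ b               ≈⟨ S.+-identityˡ b ⟩
    b                    ∎
    where
    open import Relation.Binary.Reasoning.Setoid S.setoid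
    open SeriesSolver
    difference : (a ⊕ -ₛ b) ⋆ d ≋ 0ₛ
    difference = begin
      (a ⊕ -ₛ b) ⋆ d       ≈⟨ solve 3 (λ a b d → (a :- b) :* d := a :* d :- b :* d) S.refl a b d ⟩
      a ⋆ d ⊕ -ₛ (b ⋆ d)   ≈⟨ S.+-congʳ a⋆d≋b⋆d ⟩
      b ⋆ d ⊕ -ₛ (b ⋆ d)   ≈⟨ S.-‿inverseʳ (b ⋆ d) ⟩
      0ₛ                   ∎

  Deg≤ : Series → ℕ → Set
  Deg≤ f d = ∀ n → d < n → f n ≡ 0ℚ

  Deg≤-⋆ : ∀ {f g a b} → Deg≤ f a → Deg≤ g b → Deg≤ (f ⋆ g) (a ℕ.+ b)
  Deg≤-⋆ {f} {g} {a} {b} f≤a g≤b n a+b<n = sumTo-zero n term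
    where
    term : ∀ i → i ≤ n → f i * g (n ∸ i) ≡ 0ℚ
    term i i≤n with i ℕ.≤? a
    ... | yes i≤a = trans (cong (f i *_) (g≤b (n ∸ i) b<n-i)) (*-zeroʳ (f i))
      where
      b<n-i : b < n ∸ i
      b<n-i = ℕ.+-cancelˡ-< i b (n ∸ i)
        (ℕ.≤-<-trans (ℕ.+-monoˡ-≤ b i≤a) (subst (a ℕ.+ b <_) (sym (ℕ.m+[n∸m]≡n i≤n)) a+b<n))
    ... | no i≰a = trans (cong (_* g (n ∸ i)) (f≤a i (ℕ.≰⇒> i≰a))) (*-zeroˡ (g (n ∸ i)))

  Deg≤-⊕ : ∀ {f g a} → Deg≤ f a → Deg≤ g a → Deg≤ (f ⊕ g) a
  Deg≤-⊕ f≤a g≤a n a<n = trans (cong₂ _+_ (f≤a n a<n) (g≤a n a<n)) (+-identityʳ 0ℚ)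

  Deg≤-mono : ∀ {f a b} → a ≤ b → Deg≤ f a → Deg≤ f b
  Deg≤-mono a≤b f≤a n b<n = f≤a n (ℕ.≤-<-trans a≤b b<n)

  Deg≤-cst : ∀ {a d} → Deg≤ (cst a) d
  Deg≤-cst (suc n) _ = refl

  Deg≤-X : Deg≤ X 1
  Deg≤-X (suc zero)    (s≤s ())
  Deg≤-X (suc (suc n)) _ = refl

  Deg≤-^ : ∀ {f a} n → Deg≤ f a → Deg≤ (f ^ n) (n ℕ.* a)
  Deg≤-^ zero    f≤a = Deg≤-cst
  Deg≤-^ (suc n) f≤a = Deg≤-⋆ f≤a (Deg≤-^ n f≤a)

  poly : List ℚ → Series
  poly []       = cst 0ℚ
  poly (a ∷ as) = cst a ⊕ X ⋆ poly as

  coefficient : List ℚ → ℕ → ℚ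
  coefficient []       _       = 0ℚ
  coefficient (a ∷ as) zero    = a
  coefficient (a ∷ as) (suc m) = coefficient as m

  convolve : List ℚ → Series → ℕ → ℚ
  convolve []       f m       = 0ℚ
  convolve (a ∷ as) f zero    = a * f 0
  convolve (a ∷ as) f (suc m) = a * f (suc m) + convolve as f m

  poly-coefficient : ∀ as m → poly as m ≡ coefficient as m
  poly-coefficient []       zero    = refl
  poly-coefficient []       (suc m) = refl
  poly-coefficient (a ∷ as) zero    = trans (cong (a +_) (X-⋆-zero (poly as))) (+-identityʳ a)
  poly-coefficient (a ∷ as) (suc m) =
    trans (+-identityˡ _) (trans (X-⋆-suc (poly as) m) (poly-coefficient as m))

  poly-⋆ : ∀ as f m → (poly as ⋆ f) m ≡ convolve as f m
  poly-⋆ []       f m = trans (cst-⋆ 0ℚ f m) (*-zeroˡ (f m))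
  poly-⋆ (a ∷ as) f m = trans (at (⋆-distribʳ f (cst a) (X ⋆ poly as)) m)
    (trans (cong₂ _+_ (cst-⋆ a f m) (at (⋆-assoc X (poly as) f) m)) (shift m))
    where
    shift : ∀ m → a * f m + (X ⋆ (poly as ⋆ f)) m ≡ convolve (a ∷ as) f m
    shift zero    = trans (cong (a * f 0 +_) (X-⋆-zero (poly as ⋆ f))) (+-identityʳ (a * f 0))
    shift (suc m) = cong (a * f (suc m) +_) (trans (X-⋆-suc (poly as ⋆ f) m) (poly-⋆ as f m))

module SeriesIntegrality (p : ℕ) (p-prime : Prime p) where
  open RationalEmbedding
  open Integrality p p-prime
  open FiniteSums
  open PowerSeries
  open import Data.Nat as ℕ using (zero; suc; _≤_; _<_; _∸_; z≤n; s≤s)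
  import Data.Nat.Properties as ℕ
  open import Data.Nat.Divisibility using (_∣_; _∣?_; _∣0)
  open import Data.Nat.Primality using (prime⇒nonZero)
  open import Data.Empty using (⊥-elim)
  open import Data.Nat.Induction using (<-rec)
  open import Data.Integer as ℤ using (ℤ)
  open import Data.Rational hiding (_≤_; _<_; ∣_∣)
  open import Data.Rational.Properties
  open import Data.Product using (∃; _,_; proj₁; proj₂)
  open import Relation.Nullary using (¬_; yes; no)
  open import Relation.Binary.PropositionalEquality
  import Tactic.RingSolver as Solver

  sumTo-Integral : ∀ n {F : ℕ → ℚ} → (∀ i → i ≤ n → Integral (F i)) → Integral (sumTo n F)
  sumTo-Integral zero    F-int = F-int 0 z≤n
  sumTo-Integral (suc n) F-int =
    Integral-+ (sumTo-Integral n (λ i i≤n → F-int i (ℕ.m≤n⇒m≤1+n i≤n))) (F-int (suc n) ℕ.≤-refl)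

  sumTo-Vanishing : ∀ n {F : ℕ → ℚ} → (∀ i → i ≤ n → Vanishing (F i)) → Vanishing (sumTo n F)
  sumTo-Vanishing zero    F-van = F-van 0 z≤n
  sumTo-Vanishing (suc n) F-van =
    Vanishing-+ (sumTo-Vanishing n (λ i i≤n → F-van i (ℕ.m≤n⇒m≤1+n i≤n))) (F-van (suc n) ℕ.≤-refl)

  sumTo-minus-term : ∀ n {F : ℕ → ℚ} j → j ≤ n → (∀ i → i ≤ n → ¬ i ≡ j → Vanishing (F i)) →
                     Vanishing (sumTo n F - F j)
  sumTo-minus-term zero {F} zero z≤n _ = subst Vanishing (sym (+-inverseʳ (F 0))) Vanishing-0
  sumTo-minus-term (suc n) {F} j j≤1+n others with j ℕ.≤? n
  ... | yes j≤n = subst Vanishing (move (sumTo n F) (F (suc n)) (F j))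
    (Vanishing-+ (sumTo-minus-term n j j≤n (λ i i≤n → others i (ℕ.m≤n⇒m≤1+n i≤n)))
                 (others (suc n) ℕ.≤-refl (λ 1+n≡j → ℕ.<-irrefl (sym 1+n≡j) (s≤s j≤n))))
    where
    move : ∀ s a b → (s - b) + a ≡ (s + a) - b
    move = Solver.solve-∀ ℚ-ring
  ... | no j≰n rewrite ℕ.≤-antisym j≤1+n (ℕ.≰⇒> j≰n) =
    subst Vanishing (sym (cancel (sumTo n F) (F (suc n))))
      (sumTo-Vanishing n (λ i i≤n → others i (ℕ.m≤n⇒m≤1+n i≤n) (λ i≡1+n → ℕ.<-irrefl i≡1+n (s≤s i≤n))))
    where
    cancel : ∀ s a → (s + a) - a ≡ s
    cancel = Solver.solve-∀ ℚ-ring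

  vanishing-term : ∀ n {F : ℕ → ℚ} j → j ≤ n → (∀ i → i ≤ n → ¬ i ≡ j → Vanishing (F i)) →
                   Vanishing (sumTo n F) → Vanishing (F j)
  vanishing-term n {F} j j≤n others sum-van =
    subst Vanishing (cancel (sumTo n F) (F j))
      (Vanishing-+ sum-van (Vanishing-neg (sumTo-minus-term n j j≤n others)))
    where
    cancel : ∀ s a → s + - (s - a) ≡ a
    cancel = Solver.solve-∀ ℚ-ring

  record IntegralSeries (f : Series) : Set where
    constructor integralSeries
    field coeff : ∀ n → Integral (f n)
  open IntegralSeries public

  IntegralUpTo : ℕ → Series → Set
  IntegralUpTo N f = ∀ n → n ≤ N → Integral (f n)

  IntegralSeries⇒IntegralUpTo : ∀ {f} N → IntegralSeries f → IntegralUpTo N f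
  IntegralSeries⇒IntegralUpTo N f-int n _ = coeff f-int n

  IntegralUpTo-⋆ : ∀ {f g} N → IntegralUpTo N f → IntegralUpTo N g → IntegralUpTo N (f ⋆ g)
  IntegralUpTo-⋆ N f-int g-int n n≤N = sumTo-Integral n (λ i i≤n →
    Integral-* (f-int i (ℕ.≤-trans i≤n n≤N)) (g-int (n ∸ i) (ℕ.≤-trans (ℕ.m∸n≤m n i) n≤N)))

  IntegralSeries-⋆ : ∀ {f g} → IntegralSeries f → IntegralSeries g → IntegralSeries (f ⋆ g)
  IntegralSeries-⋆ f-int g-int = integralSeries λ n →
    IntegralUpTo-⋆ n (IntegralSeries⇒IntegralUpTo n f-int) (IntegralSeries⇒IntegralUpTo n g-int) n ℕ.≤-refl

  IntegralSeries-⊕ : ∀ {f g} → IntegralSeries f → IntegralSeries g → IntegralSeries (f ⊕ g)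
  IntegralSeries-⊕ f-int g-int = integralSeries λ n → Integral-+ (coeff f-int n) (coeff g-int n)

  IntegralSeries-neg : ∀ {f} → IntegralSeries f → IntegralSeries (-ₛ f)
  IntegralSeries-neg f-int = integralSeries λ n → Integral-neg (coeff f-int n)

  IntegralSeries-cst : ∀ {a} → Integral a → IntegralSeries (cst a)
  IntegralSeries-cst a-int = integralSeries λ { zero → a-int ; (suc n) → Integral-ℕ 0 }

  IntegralSeries-X : IntegralSeries X
  IntegralSeries-X = integralSeries λ { 1 → Integral-ℕ 1 ; zero → Integral-ℕ 0 ; (suc (suc n)) → Integral-ℕ 0 }

  IntegralSeries-∂ : ∀ {f} → IntegralSeries f → IntegralSeries (∂ f)
  IntegralSeries-∂ f-int = integralSeries λ n → Integral-* (Integral-ℕ (suc n)) (coeff f-int (suc n))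

  IntegralSeries-^ : ∀ {f} n → IntegralSeries f → IntegralSeries (f ^ n)
  IntegralSeries-^ zero    f-int = IntegralSeries-cst (Integral-ℕ 1)
  IntegralSeries-^ (suc n) f-int = IntegralSeries-⋆ f-int (IntegralSeries-^ n f-int)

  IntegralSeries-≋ : ∀ {f g} → f ≋ g → IntegralSeries f → IntegralSeries g
  IntegralSeries-≋ f≋g f-int = integralSeries λ n → subst Integral (at f≋g n) (coeff f-int n)

  Vanishing-p⋆ : ∀ {f} → IntegralSeries f → ∀ n → Vanishing ((cst (ℕ→ℚ p) ⋆ f) n)
  Vanishing-p⋆ {f} f-int n = subst Vanishing (sym (cst-⋆ (ℕ→ℚ p) f n)) (Vanishing-*ʳ Vanishing-p (coeff f-int n))

  IntegralSeries-sqrt : ∀ {f q u} → f ⋆ f ≋ q → IntegralSeries q → Integral (f 0) → Integral u →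
                        u * (f 0 + f 0) ≡ 1ℚ → IntegralSeries f
  IntegralSeries-sqrt {f} {q} {u} ff≋q q-int f₀-int u-int u[f₀+f₀]≡1 =
    integralSeries (<-rec (λ n → Integral (f n)) step)
    where
    -- (f ⋆ f) n = 2 f₀ fₙ + (terms involving only lower coefficients)
    isolate : ∀ n M → (f ⋆ f) n ≡ (f 0 + f 0) * f n + M → Integral M → Integral (f n)
    isolate n M ff≡ M-int = subst Integral fₙ≡ (Integral-* u-int (Integral-+ (coeff q-int n) (Integral-neg M-int)))
      where
      open ≡-Reasoning
      regroup : ∀ u a x M → u * ((a * x + M) - M) ≡ (u * a) * x
      regroup = Solver.solve-∀ ℚ-ring
      fₙ≡ : u * (q n - M) ≡ f n
      fₙ≡ = begin
        u * (q n - M)                       ≡⟨ cong (λ t → u * (t - M)) (trans (sym (at ff≋q n)) ff≡) ⟩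
        u * (((f 0 + f 0) * f n + M) - M)   ≡⟨ regroup u (f 0 + f 0) (f n) M ⟩
        (u * (f 0 + f 0)) * f n             ≡⟨ cong (_* f n) u[f₀+f₀]≡1 ⟩
        1ℚ * f n                            ≡⟨ *-identityˡ (f n) ⟩
        f n                                 ∎
    step : ∀ n → (∀ {m} → m < n → Integral (f m)) → Integral (f n)
    step zero          _  = f₀-int
    step (suc zero)    _  = isolate 1 0ℚ (two-ends (f 0) (f 1)) (Integral-ℕ 0)
      where
      two-ends : ∀ a b → a * b + b * a ≡ (a + a) * b + 0ℚ
      two-ends = Solver.solve-∀ ℚ-ring
    step (suc (suc j)) ih = isolate (suc (suc j)) middle ends middle-int
      where
      middle : ℚ
      middle = sumTo j (λ i → f (suc i) * f (suc j ∸ i))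
      middle-int : Integral middle
      middle-int = sumTo-Integral j (λ i i≤j →
        Integral-* (ih (s≤s (s≤s i≤j))) (ih (s≤s (ℕ.m∸n≤m (suc j) i))))
      two-ends : ∀ a b m → (a * b + m) + b * a ≡ (a + a) * b + m
      two-ends = Solver.solve-∀ ℚ-ring
      ends : (f ⋆ f) (suc (suc j)) ≡ (f 0 + f 0) * f (suc (suc j)) + middle
      ends = trans (cong₂ _+_ (sumTo-head j _) (cong (λ m → f (suc (suc j)) * f m) (ℕ.n∸n≡0 j)))
                   (two-ends (f 0) (f (suc (suc j))) middle)

  vanishing-from-squares : ∀ {f} → IntegralSeries f → (∀ i → Vanishing ((f ⋆ f) (i ℕ.+ i))) →
                           ∀ i → Vanishing (f i)
  vanishing-from-squares {f} f-int ff-van = <-rec (λ i → Vanishing (f i)) step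
    where
    step : ∀ i → (∀ {j} → j < i → Vanishing (f j)) → Vanishing (f i)
    step i ih = Vanishing-square (coeff f-int i)
      (subst (λ m → Vanishing (f i * f m)) (ℕ.m+n∸m≡n i i)
        (vanishing-term (i ℕ.+ i) i (ℕ.m≤m+n i i) others (ff-van i)))
      where
      others : ∀ a → a ≤ i ℕ.+ i → ¬ a ≡ i → Vanishing (f a * f ((i ℕ.+ i) ∸ a))
      others a a≤2i a≢i with a ℕ.<? i
      ... | yes a<i = Vanishing-*ʳ (ih a<i) (coeff f-int _)
      ... | no  a≮i = Vanishing-*ˡ (coeff f-int a)
        (ih (subst ((i ℕ.+ i) ∸ a <_) (ℕ.m+n∸m≡n i i)
              (ℕ.∸-monoʳ-< (ℕ.≤∧≢⇒< (ℕ.≮⇒≥ a≮i) (λ i≡a → a≢i (sym i≡a))) a≤2i)))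

  -- By the power rule m (fᵖ)ₘ = p (fᵖ⁻¹ f′)ₘ₋₁, so (fᵖ)ₘ ≡ 0 (mod p) unless p ∣ m.
  ^p-vanishing : ∀ {f} → IntegralSeries f → ∀ m → ¬ p ∣ m → Vanishing ((f ^ p) m)
  ^p-vanishing {f} f-int zero    p∤0   = ⊥-elim (p∤0 (p ∣0))
  ^p-vanishing {f} f-int (suc m) p∤1+m =
    subst (λ k → Vanishing ((f ^ k) (suc m))) (ℕ.suc-pred p)
      (power-rule (ℕ.pred p) (subst (λ k → Vanishing (ℕ→ℚ k)) (sym (ℕ.suc-pred p)) Vanishing-p))
    where
    instance
      p≢0 : ℕ.NonZero p
      p≢0 = prime⇒nonZero p-prime
    power-rule : ∀ n → Vanishing (ℕ→ℚ (suc n)) → Vanishing ((f ^ suc n) (suc m))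
    power-rule n 1+n-van = Vanishing-cancelˡ p∤1+m (subst Vanishing (sym ∂fᵖ≡) (Vanishing-*ʳ 1+n-van fⁿ∂f-int))
      where
      fⁿ∂f-int : Integral ((f ^ n ⋆ ∂ f) m)
      fⁿ∂f-int = coeff (IntegralSeries-⋆ (IntegralSeries-^ n f-int) (IntegralSeries-∂ f-int)) m
      ∂fᵖ≡ : ℕ→ℚ (suc m) * (f ^ suc n) (suc m) ≡ ℕ→ℚ (suc n) * (f ^ n ⋆ ∂ f) m
      ∂fᵖ≡ = trans (at (∂-^ f n) m) (cst-⋆ (ℕ→ℚ (suc n)) (f ^ n ⋆ ∂ f) m)

  exactness-criterion : ∀ {g} → PIntegralSeries p g → (∀ n → p ∣ suc n → Vanishing (g n)) → ExactModP p g
  exactness-criterion {g} g-int p∣⇒vanishing =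
    lift , λ n → Vanishing⇒ZeroModP {g n - ℕ→ℚ (suc n) * ℤ→ℚ (lift (suc n))} (proj₂ (lifted n))
    where
    g≡g-0 : ∀ n → g n ≡ g n - ℕ→ℚ (suc n) * ℤ→ℚ (ℤ.+ 0)
    g≡g-0 n = sym (trans (cong (λ t → g n - t) (*-zeroʳ (ℕ→ℚ (suc n)))) (+-identityʳ (g n)))
    lifted : ∀ n → ∃ λ z → Vanishing (g n - ℕ→ℚ (suc n) * ℤ→ℚ z)
    lifted n with p ∣? suc n
    ... | yes p∣1+n = ℤ.+ 0 , subst Vanishing (g≡g-0 n) (p∣⇒vanishing n p∣1+n)
    ... | no  p∤1+n = lift-mod (PIntegral⇒Integral {g n} (g-int n)) p∤1+n
    lift : ℕ → ℤ
    lift zero    = ℤ.+ 0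
    lift (suc n) = proj₁ (lifted n)

  -- Read off σ₀², σ₂² and σ₁² from the coefficients 0, 4 and 2 of σ².
  IntegralSeries-sqrt-quadratic : ∀ {σ} → Deg≤ σ 2 → IntegralSeries (σ ⋆ σ) → IntegralSeries σ
  IntegralSeries-sqrt-quadratic {σ} σ≤2 σ²-int = integralSeries coefficients
    where
    σ₀-int : Integral (σ 0)
    σ₀-int = Integral-square (coeff σ²-int 0)
    σ₂-int : Integral (σ 2)
    σ₂-int = Integral-square (subst Integral σ²₄≡σ₂² (coeff σ²-int 4))
      where
      σ²₄≡σ₂² : (σ ⋆ σ) 4 ≡ σ 2 * σ 2
      σ²₄≡σ₂² = trans (cong₂ (λ a b → σ 0 * b + σ 1 * a + σ 2 * σ 2 + a * σ 1 + b * σ 0)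
                              (σ≤2 3 (s≤s (s≤s (s≤s z≤n)))) (σ≤2 4 (s≤s (s≤s (s≤s z≤n)))))
                      (middle (σ 0) (σ 1) (σ 2))
        where
        middle : ∀ a b c → a * 0ℚ + b * 0ℚ + c * c + 0ℚ * b + 0ℚ * a ≡ c * c
        middle = Solver.solve-∀ ℚ-ring
    σ₁-int : Integral (σ 1)
    σ₁-int = Integral-square (subst Integral (middle (σ 0) (σ 1) (σ 2))
      (Integral-+ (Integral-+ (coeff σ²-int 2) (Integral-neg (Integral-* σ₀-int σ₂-int)))
                  (Integral-neg (Integral-* σ₂-int σ₀-int))))
      where
      middle : ∀ a b c → (a * c + b * b + c * a) - a * c - c * a ≡ b * b
      middle = Solver.solve-∀ ℚ-ring
    coefficients : ∀ n → Integral (σ n)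
    coefficients 0 = σ₀-int
    coefficients 1 = σ₁-int
    coefficients 2 = σ₂-int
    coefficients (suc (suc (suc n))) = subst Integral (sym (σ≤2 (3 ℕ.+ n) (s≤s (s≤s (s≤s z≤n))))) (Integral-ℕ 0)

module Curve where
  open RationalEmbedding
  open PowerSeries
  open import Data.Nat as ℕ using (zero; suc; z≤n; s≤s)
  open import Data.Rational hiding (_≤_; _<_)
  open import Data.Rational.Properties
  open import Relation.Binary.PropositionalEquality
  import Tactic.RingSolver as Solver

  1+2X : Series
  1+2X = cst (ℕ→ℚ 1) ⊕ cst (ℕ→ℚ 2) ⋆ X

  [1+2X]⁻¹ : Series
  [1+2X]⁻¹ zero    = 1ℚ
  [1+2X]⁻¹ (suc n) = - ℕ→ℚ 2 * [1+2X]⁻¹ n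

  [1+2X]⁻¹-inverse : [1+2X]⁻¹ ⋆ 1+2X ≋ 1ₛ
  [1+2X]⁻¹-inverse = S.trans expand (pointwise coefficients)
    where
    open SeriesSolver
    E : Series
    E = [1+2X]⁻¹
    expand : E ⋆ 1+2X ≋ E ⊕ cst (ℕ→ℚ 2) ⋆ (X ⋆ E)
    expand = solve 2 (λ e x → e :* (con (ℕ→ℚ 1) :+ con (ℕ→ℚ 2) :* x) := e :+ con (ℕ→ℚ 2) :* (x :* e)) S.refl E X
    cancel : ∀ e → - ℕ→ℚ 2 * e + ℕ→ℚ 2 * e ≡ 0ℚ
    cancel = Solver.solve-∀ ℚ-ring
    coefficients : ∀ n → (E ⊕ cst (ℕ→ℚ 2) ⋆ (X ⋆ E)) n ≡ 1ₛ n
    coefficients zero    = cong (1ℚ +_) (trans (cst-⋆ (ℕ→ℚ 2) (X ⋆ E) 0) (cong (ℕ→ℚ 2 *_) (X-⋆-zero E)))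
    coefficients (suc n) = trans (cong (E (suc n) +_) (trans (cst-⋆ (ℕ→ℚ 2) (X ⋆ E) (suc n))
                                                             (cong (ℕ→ℚ 2 *_) (X-⋆-suc E n))))
                                 (cancel (E n))

  ∂-1+2X : ∂ 1+2X ≋ cst (ℕ→ℚ 2)
  ∂-1+2X = begin
    ∂ (cst (ℕ→ℚ 1) ⊕ cst (ℕ→ℚ 2) ⋆ X)             ≈⟨ ∂-⊕ (cst (ℕ→ℚ 1)) (cst (ℕ→ℚ 2) ⋆ X) ⟩
    ∂ (cst (ℕ→ℚ 1)) ⊕ ∂ (cst (ℕ→ℚ 2) ⋆ X)          ≈⟨ S.+-cong (∂-cst (ℕ→ℚ 1)) (∂-⋆ (cst (ℕ→ℚ 2)) X) ⟩
    0ₛ ⊕ (∂ (cst (ℕ→ℚ 2)) ⋆ X ⊕ cst (ℕ→ℚ 2) ⋆ ∂ X)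
      ≈⟨ S.+-congˡ {0ₛ} (S.+-cong (S.*-congʳ {X} (∂-cst (ℕ→ℚ 2))) (S.*-congˡ {cst (ℕ→ℚ 2)} ∂-X)) ⟩
    0ₛ ⊕ (0ₛ ⋆ X ⊕ cst (ℕ→ℚ 2) ⋆ 1ₛ)                ≈⟨ S.+-identityˡ _ ⟩
    0ₛ ⋆ X ⊕ cst (ℕ→ℚ 2) ⋆ 1ₛ                       ≈⟨ S.+-congʳ (S.zeroˡ X) ⟩
    0ₛ ⊕ cst (ℕ→ℚ 2) ⋆ 1ₛ                           ≈⟨ S.+-identityˡ _ ⟩
    cst (ℕ→ℚ 2) ⋆ 1ₛ                                ≈⟨ S.*-identityʳ _ ⟩
    cst (ℕ→ℚ 2)                                    ∎
    where open import Relation.Binary.Reasoning.Setoid S.setoid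

  ∂-Qser : ∂ Qser ≋ cst (ℕ→ℚ 2) ⋆ ((X ⊕ X ⋆ X) ⋆ 1+2X)
  ∂-Qser = begin
    ∂ (cst (ℕ→ℚ 4) ⊕ u ⋆ u)             ≈⟨ ∂-⊕ (cst (ℕ→ℚ 4)) (u ⋆ u) ⟩
    ∂ (cst (ℕ→ℚ 4)) ⊕ ∂ (u ⋆ u)         ≈⟨ S.+-cong (∂-cst (ℕ→ℚ 4)) (∂-⋆ u u) ⟩
    0ₛ ⊕ (∂ u ⋆ u ⊕ u ⋆ ∂ u)            ≈⟨ S.+-identityˡ _ ⟩
    ∂ u ⋆ u ⊕ u ⋆ ∂ u                   ≈⟨ S.+-cong (S.*-congʳ {u} ∂u≋1+2X) (S.*-congˡ {u} ∂u≋1+2X) ⟩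
    1+2X ⋆ u ⊕ u ⋆ 1+2X                 ≈⟨ solve 2 (λ p u → p :* u :+ u :* p := con (ℕ→ℚ 2) :* (u :* p)) S.refl 1+2X u ⟩
    cst (ℕ→ℚ 2) ⋆ (u ⋆ 1+2X)            ∎
    where
    open import Relation.Binary.Reasoning.Setoid S.setoid
    open SeriesSolver
    u : Series
    u = X ⊕ X ⋆ X
    ∂u≋1+2X : ∂ u ≋ 1+2X
    ∂u≋1+2X = begin
      ∂ (X ⊕ X ⋆ X)                 ≈⟨ ∂-⊕ X (X ⋆ X) ⟩
      ∂ X ⊕ ∂ (X ⋆ X)               ≈⟨ S.+-congˡ {∂ X} (∂-⋆ X X) ⟩
      ∂ X ⊕ (∂ X ⋆ X ⊕ X ⋆ ∂ X)     ≈⟨ S.+-cong ∂-X (S.+-cong (S.*-congʳ {X} ∂-X) (S.*-congˡ {X} ∂-X)) ⟩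
      1ₛ ⊕ (1ₛ ⋆ X ⊕ X ⋆ 1ₛ)        ≈⟨ solve 1 (λ x → con 1ℚ :+ (con 1ℚ :* x :+ x :* con 1ℚ)
                                                   := con (ℕ→ℚ 1) :+ con (ℕ→ℚ 2) :* x) S.refl X ⟩
      1+2X                          ∎

  Deg≤-1+2X : Deg≤ 1+2X 1
  Deg≤-1+2X = Deg≤-⊕ (Deg≤-cst {d = 1}) (Deg≤-⋆ (Deg≤-cst {d = 0}) Deg≤-X)

  Deg≤-Qser : Deg≤ Qser 4
  Deg≤-Qser = Deg≤-⊕ (Deg≤-cst {d = 4}) (Deg≤-⋆ Deg≤-u Deg≤-u)
    where
    Deg≤-u : Deg≤ (X ⊕ X ⋆ X) 2
    Deg≤-u = Deg≤-⊕ (Deg≤-mono (s≤s z≤n) Deg≤-X) (Deg≤-⋆ Deg≤-X Deg≤-X)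

  Deg≤-Rt : ∀ C → Deg≤ (Rt C) 2
  Deg≤-Rt C = Deg≤-⊕ (Deg≤-⊕ (Deg≤-cst {d = 2}) (Deg≤-mono (s≤s z≤n) (Deg≤-⋆ (Deg≤-cst {d = 0}) Deg≤-X)))
                     (Deg≤-⋆ (Deg≤-⋆ (Deg≤-cst {d = 0}) Deg≤-X) Deg≤-X)

module CurveIntegrality (p : ℕ) (p-prime : Prime p) where
  open PowerSeries
  open Curve
  open Integrality p p-prime
  open SeriesIntegrality p p-prime
  open import Data.Nat using (zero; suc)

  IntegralSeries-1+2X : IntegralSeries 1+2X
  IntegralSeries-1+2X = IntegralSeries-⊕ (IntegralSeries-cst (Integral-ℕ 1))
                                         (IntegralSeries-⋆ (IntegralSeries-cst (Integral-ℕ 2)) IntegralSeries-X)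

  IntegralSeries-[1+2X]⁻¹ : IntegralSeries [1+2X]⁻¹
  IntegralSeries-[1+2X]⁻¹ = integralSeries coefficients
    where
    coefficients : ∀ n → Integral ([1+2X]⁻¹ n)
    coefficients zero    = Integral-ℕ 1
    coefficients (suc n) = Integral-* (Integral-neg (Integral-ℕ 2)) (coefficients n)

  IntegralSeries-Qser : IntegralSeries Qser
  IntegralSeries-Qser = IntegralSeries-⊕ (IntegralSeries-cst (Integral-ℕ 4)) (IntegralSeries-⋆ u-int u-int)
    where
    u-int : IntegralSeries (X ⊕ X ⋆ X)
    u-int = IntegralSeries-⊕ IntegralSeries-X (IntegralSeries-⋆ IntegralSeries-X IntegralSeries-X)

module RecurrenceAsODE (C : ℕ → ℚ) (recurrence : ∀ n → Recurrence C n) where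
  open RationalEmbedding
  open PowerSeries
  open import Data.Nat as ℕ using (zero; suc)
  import Data.Nat.Properties as ℕ
  open import Data.Rational hiding (_≤_; _<_)
  open import Data.Rational.Properties
  open import Data.List using (List; []; _∷_)
  open import Relation.Binary.PropositionalEquality
  import Tactic.RingSolver as Solver

  -- ℕ→ℚ by repeated successor, so that unary (k + n) unfolds to unary n + 1 + ⋯ + 1.
  unary : ℕ → ℚ
  unary zero    = 0ℚ
  unary (suc n) = unary n + 1ℚ

  ℕ→ℚ≡unary : ∀ n → ℕ→ℚ n ≡ unary n
  ℕ→ℚ≡unary zero    = refl
  ℕ→ℚ≡unary (suc n) = trans (ℕ→ℚ-homo-+ 1 n) (trans (+-comm 1ℚ (ℕ→ℚ n)) (cong (_+ 1ℚ) (ℕ→ℚ≡unary n)))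

  recurrence-unary : ∀ n →
    ℕ→ℚ 4 * (unary n + ℕ→ℚ 4) * C (5 ℕ.+ n) + ℕ→ℚ 8 * (unary n + ℕ→ℚ 2) * C (4 ℕ.+ n)
    + (unary n + ℕ→ℚ 3) * C (3 ℕ.+ n) + (ℕ→ℚ 4 * unary n + ℕ→ℚ 7) * C (2 ℕ.+ n)
    + (ℕ→ℚ 5 * unary n + ℕ→ℚ 4) * C (1 ℕ.+ n) + ℕ→ℚ 2 * unary n * C n ≡ 0ℚ
  recurrence-unary n = trans
    (sym (cong₂ _+_ (cong₂ _+_ (cong₂ _+_ (cong₂ _+_ (cong₂ _+_
      (cong₂ _*_ (cong (ℕ→ℚ 4 *_) (shifted 4)) (index 5))
      (cong₂ _*_ (cong (ℕ→ℚ 8 *_) (shifted 2)) (index 4)))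
      (cong₂ _*_ (shifted 3) (index 3)))
      (cong₂ _*_ (affine 4 7) (index 2)))
      (cong₂ _*_ (affine 5 4) (index 1)))
      (cong (_* C n) (trans (ℕ→ℚ-homo-* 2 n) (cong (ℕ→ℚ 2 *_) (ℕ→ℚ≡unary n))))))
    (recurrence n)
    where
    shifted : ∀ j → ℕ→ℚ (n ℕ.+ j) ≡ unary n + ℕ→ℚ j
    shifted j = trans (ℕ→ℚ-homo-+ n j) (cong (_+ ℕ→ℚ j) (ℕ→ℚ≡unary n))
    affine : ∀ a j → ℕ→ℚ (a ℕ.* n ℕ.+ j) ≡ ℕ→ℚ a * unary n + ℕ→ℚ j
    affine a j = trans (ℕ→ℚ-homo-+ (a ℕ.* n) j)
                       (cong (_+ ℕ→ℚ j) (trans (ℕ→ℚ-homo-* a n) (cong (ℕ→ℚ a *_) (ℕ→ℚ≡unary n))))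
    index : ∀ j → C (n ℕ.+ j) ≡ C (j ℕ.+ n)
    index j = cong C (ℕ.+-comm n j)

  H : Series
  H n = C (suc n)

  H′ : Series
  H′ k = unary (suc k) * C (suc (suc k))

  ∂H≋H′ : ∂ H ≋ H′
  ∂H≋H′ = pointwise λ k → cong (_* C (suc (suc k))) (ℕ→ℚ≡unary (suc k))

  -- (1 + 2x) Q(x) and ½ (1 + 2x) Q′(x) − 2 Q(x)
  P-∂H P-H : List ℚ
  P-∂H = ℕ→ℚ 4 ∷ ℕ→ℚ 8 ∷ ℕ→ℚ 1 ∷ ℕ→ℚ 4 ∷ ℕ→ℚ 5 ∷ ℕ→ℚ 2 ∷ []
  P-H  = - ℕ→ℚ 8 ∷ ℕ→ℚ 1 ∷ ℕ→ℚ 3 ∷ ℕ→ℚ 4 ∷ ℕ→ℚ 2 ∷ []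

  R̃ : List ℚ
  R̃ = ℕ→ℚ 4 * C 2 - ℕ→ℚ 8 * C 1
    ∷ ℕ→ℚ 8 * C 3 + C 1
    ∷ ℕ→ℚ 12 * C 4 + ℕ→ℚ 8 * C 3 + ℕ→ℚ 2 * C 2 + ℕ→ℚ 3 * C 1
    ∷ []

  private
    4ℚ 8ℚ 3ℚ 5ℚ 2ℚ 7ℚ 12ℚ -8ℚ : ℚ
    4ℚ = ℕ→ℚ 4
    8ℚ = ℕ→ℚ 8
    3ℚ = ℕ→ℚ 3
    5ℚ = ℕ→ℚ 5
    2ℚ = ℕ→ℚ 2
    7ℚ = ℕ→ℚ 7
    12ℚ = ℕ→ℚ 12
    -8ℚ = - ℕ→ℚ 8

  -- In the coefficients 3 + n the recurrence at n appears; the first three give R̃.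
  ode-coefficient : ∀ m → convolve P-∂H H′ m + convolve P-H H m ≡ coefficient R̃ m
  ode-coefficient 0 = coefficient₀ (C 1) (C 2)
    where
    coefficient₀ : ∀ c₁ c₂ → 4ℚ * ((0ℚ + 1ℚ) * c₂) + -8ℚ * c₁ ≡ 4ℚ * c₂ - 8ℚ * c₁
    coefficient₀ = Solver.solve-∀ ℚ-ring
  ode-coefficient 1 = coefficient₁ (C 1) (C 2) (C 3)
    where
    coefficient₁ : ∀ c₁ c₂ c₃ → (4ℚ * ((0ℚ + 1ℚ + 1ℚ) * c₃) + 8ℚ * ((0ℚ + 1ℚ) * c₂))
                                 + (-8ℚ * c₂ + ℕ→ℚ 1 * c₁)
                               ≡ 8ℚ * c₃ + c₁
    coefficient₁ = Solver.solve-∀ ℚ-ring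
  ode-coefficient 2 = coefficient₂ (C 1) (C 2) (C 3) (C 4)
    where
    coefficient₂ : ∀ c₁ c₂ c₃ c₄ →
      (4ℚ * ((0ℚ + 1ℚ + 1ℚ + 1ℚ) * c₄) + (8ℚ * ((0ℚ + 1ℚ + 1ℚ) * c₃) + ℕ→ℚ 1 * ((0ℚ + 1ℚ) * c₂)))
      + (-8ℚ * c₃ + (ℕ→ℚ 1 * c₂ + 3ℚ * c₁))
      ≡ 12ℚ * c₄ + 8ℚ * c₃ + 2ℚ * c₂ + 3ℚ * c₁
    coefficient₂ = Solver.solve-∀ ℚ-ring
  ode-coefficient 3 = trans (coefficient₃ (C 0) (C 1) (C 2) (C 3) (C 4) (C 5)) (recurrence-unary 0)
    where
    coefficient₃ : ∀ c₀ c₁ c₂ c₃ c₄ c₅ →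
      (4ℚ * ((0ℚ + 1ℚ + 1ℚ + 1ℚ + 1ℚ) * c₅) + (8ℚ * ((0ℚ + 1ℚ + 1ℚ + 1ℚ) * c₄)
        + (ℕ→ℚ 1 * ((0ℚ + 1ℚ + 1ℚ) * c₃) + 4ℚ * ((0ℚ + 1ℚ) * c₂))))
      + (-8ℚ * c₄ + (ℕ→ℚ 1 * c₃ + (3ℚ * c₂ + 4ℚ * c₁)))
      ≡ 4ℚ * (0ℚ + 4ℚ) * c₅ + 8ℚ * (0ℚ + 2ℚ) * c₄ + (0ℚ + 3ℚ) * c₃
        + (4ℚ * 0ℚ + 7ℚ) * c₂ + (5ℚ * 0ℚ + 4ℚ) * c₁ + 2ℚ * 0ℚ * c₀
    coefficient₃ = Solver.solve-∀ ℚ-ring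
  ode-coefficient 4 = trans (coefficient₄ (C 1) (C 2) (C 3) (C 4) (C 5) (C 6)) (recurrence-unary 1)
    where
    coefficient₄ : ∀ c₁ c₂ c₃ c₄ c₅ c₆ → let N = 0ℚ + 1ℚ in
      (4ℚ * ((N + 1ℚ + 1ℚ + 1ℚ + 1ℚ) * c₆) + (8ℚ * ((N + 1ℚ + 1ℚ + 1ℚ) * c₅)
        + (ℕ→ℚ 1 * ((N + 1ℚ + 1ℚ) * c₄) + (4ℚ * ((N + 1ℚ) * c₃) + 5ℚ * (N * c₂)))))
      + (-8ℚ * c₅ + (ℕ→ℚ 1 * c₄ + (3ℚ * c₃ + (4ℚ * c₂ + 2ℚ * c₁))))
      ≡ 4ℚ * (N + 4ℚ) * c₆ + 8ℚ * (N + 2ℚ) * c₅ + (N + 3ℚ) * c₄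
        + (4ℚ * N + 7ℚ) * c₃ + (5ℚ * N + 4ℚ) * c₂ + 2ℚ * N * c₁
    coefficient₄ = Solver.solve-∀ ℚ-ring
  ode-coefficient 5 = trans (coefficient₅ (C 2) (C 3) (C 4) (C 5) (C 6) (C 7)) (recurrence-unary 2)
    where
    coefficient₅ : ∀ c₂ c₃ c₄ c₅ c₆ c₇ → let N = 0ℚ + 1ℚ + 1ℚ in
      (4ℚ * ((N + 1ℚ + 1ℚ + 1ℚ + 1ℚ) * c₇) + (8ℚ * ((N + 1ℚ + 1ℚ + 1ℚ) * c₆)
        + (ℕ→ℚ 1 * ((N + 1ℚ + 1ℚ) * c₅) + (4ℚ * ((N + 1ℚ) * c₄) + (5ℚ * (N * c₃)
        + 2ℚ * ((0ℚ + 1ℚ) * c₂))))))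
      + (-8ℚ * c₆ + (ℕ→ℚ 1 * c₅ + (3ℚ * c₄ + (4ℚ * c₃ + (2ℚ * c₂ + 0ℚ)))))
      ≡ 4ℚ * (N + 4ℚ) * c₇ + 8ℚ * (N + 2ℚ) * c₆ + (N + 3ℚ) * c₅
        + (4ℚ * N + 7ℚ) * c₄ + (5ℚ * N + 4ℚ) * c₃ + 2ℚ * N * c₂
    coefficient₅ = Solver.solve-∀ ℚ-ring
  ode-coefficient (suc (suc (suc (suc (suc (suc k)))))) =
    trans (coefficientₙ (unary k) (C (3 ℕ.+ k)) (C (4 ℕ.+ k)) (C (5 ℕ.+ k)) (C (6 ℕ.+ k)) (C (7 ℕ.+ k)) (C (8 ℕ.+ k)))
          (recurrence-unary (3 ℕ.+ k))
    where
    coefficientₙ : ∀ K c₃ c₄ c₅ c₆ c₇ c₈ → let N = K + 1ℚ + 1ℚ + 1ℚ in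
      (4ℚ * ((N + 1ℚ + 1ℚ + 1ℚ + 1ℚ) * c₈) + (8ℚ * ((N + 1ℚ + 1ℚ + 1ℚ) * c₇)
        + (ℕ→ℚ 1 * ((N + 1ℚ + 1ℚ) * c₆) + (4ℚ * ((N + 1ℚ) * c₅) + (5ℚ * (N * c₄)
        + (2ℚ * ((K + 1ℚ + 1ℚ) * c₃) + 0ℚ))))))
      + (-8ℚ * c₇ + (ℕ→ℚ 1 * c₆ + (3ℚ * c₅ + (4ℚ * c₄ + (2ℚ * c₃ + 0ℚ)))))
      ≡ 4ℚ * (N + 4ℚ) * c₈ + 8ℚ * (N + 2ℚ) * c₇ + (N + 3ℚ) * c₆
        + (4ℚ * N + 7ℚ) * c₅ + (5ℚ * N + 4ℚ) * c₄ + 2ℚ * N * c₃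
    coefficientₙ = Solver.solve-∀ ℚ-ring

  Rt≋poly : Rt C ≋ poly R̃
  Rt≋poly = solve 4 (λ a b c x → a :+ b :* x :+ c :* x :* x := a :+ x :* (b :+ x :* (c :+ x :* con 0ℚ)))
                    S.refl (cst (ℕ→ℚ 4 * C 2 - ℕ→ℚ 8 * C 1)) (cst (ℕ→ℚ 8 * C 3 + C 1))
                    (cst (ℕ→ℚ 12 * C 4 + ℕ→ℚ 8 * C 3 + ℕ→ℚ 2 * C 2 + ℕ→ℚ 3 * C 1)) X
    where open SeriesSolver

  ode : poly P-∂H ⋆ ∂ H ⊕ poly P-H ⋆ H ≋ Rt C
  ode = pointwise λ m → begin
    (poly P-∂H ⋆ ∂ H) m + (poly P-H ⋆ H) m    ≡⟨ cong (_+ (poly P-H ⋆ H) m) (at (S.*-congˡ {poly P-∂H} ∂H≋H′) m) ⟩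
    (poly P-∂H ⋆ H′) m + (poly P-H ⋆ H) m     ≡⟨ cong₂ _+_ (poly-⋆ P-∂H H′ m) (poly-⋆ P-H H m) ⟩
    convolve P-∂H H′ m + convolve P-H H m     ≡⟨ ode-coefficient m ⟩
    coefficient R̃ m                           ≡⟨ poly-coefficient R̃ m ⟨
    poly R̃ m                                  ≡⟨ at Rt≋poly m ⟨
    Rt C m                                    ∎
    where open ≡-Reasoning

module Primitive (C : ℕ → ℚ) (recurrence : ∀ n → Recurrence C n)
               (y : Series) (y⋆y≡Q : ∀ n → (y ⋆ y) n ≡ Qser n) where
  open RationalEmbedding
  open PowerSeries
  open Curve
  open RecurrenceAsODE C recurrence
  open import Data.Rational hiding (_≤_; _<_)
  open import Relation.Binary.Reasoning.Setoid S.setoid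
  open SeriesSolver

  G : Series
  G = H ⋆ y ⋆ [1+2X]⁻¹

  private
    P E u : Series
    P = 1+2X
    E = [1+2X]⁻¹
    u = X ⊕ X ⋆ X

    y⋆y≋Q : y ⋆ y ≋ Qser
    y⋆y≋Q = pointwise y⋆y≡Q

    y⋆∂y≋ : y ⋆ ∂ y ≋ u ⋆ P
    y⋆∂y≋ = begin
      y ⋆ ∂ y                             ≈⟨ solve 2 (λ y d → y :* d := con ½ :* (d :* y :+ y :* d)) S.refl y (∂ y) ⟩
      cst ½ ⋆ (∂ y ⋆ y ⊕ y ⋆ ∂ y)         ≈⟨ S.*-congˡ {cst ½} (S.sym (∂-⋆ y y)) ⟩
      cst ½ ⋆ ∂ (y ⋆ y)                   ≈⟨ S.*-congˡ {cst ½} (S.trans (∂-cong y⋆y≋Q) ∂-Qser) ⟩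
      cst ½ ⋆ (cst (ℕ→ℚ 2) ⋆ (u ⋆ P))     ≈⟨ solve 1 (λ w → con ½ :* (con (ℕ→ℚ 2) :* w) := w) S.refl (u ⋆ P) ⟩
      u ⋆ P                               ∎

    ∂E⋆P⋆P≋ : ∂ E ⋆ (P ⋆ P) ≋ cst (- ℕ→ℚ 2)
    ∂E⋆P⋆P≋ = begin
      ∂ E ⋆ (P ⋆ P)
        ≈⟨ solve 3 (λ d e p → d :* (p :* p) := (d :* p :+ e :* con (ℕ→ℚ 2)) :* p :+ con (- ℕ→ℚ 2) :* (e :* p))
                 S.refl (∂ E) E P ⟩
      (∂ E ⋆ P ⊕ E ⋆ cst (ℕ→ℚ 2)) ⋆ P ⊕ cst (- ℕ→ℚ 2) ⋆ (E ⋆ P)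
        ≈⟨ S.+-cong (S.*-congʳ {P} ∂[E⋆P]≋0) (S.*-congˡ {cst (- ℕ→ℚ 2)} [1+2X]⁻¹-inverse) ⟩
      0ₛ ⋆ P ⊕ cst (- ℕ→ℚ 2) ⋆ 1ₛ
        ≈⟨ S.trans (S.+-congʳ (S.zeroˡ P)) (S.trans (S.+-identityˡ _) (S.*-identityʳ _)) ⟩
      cst (- ℕ→ℚ 2)                                                ∎
      where
      ∂[E⋆P]≋0 : ∂ E ⋆ P ⊕ E ⋆ cst (ℕ→ℚ 2) ≋ 0ₛ
      ∂[E⋆P]≋0 = begin
        ∂ E ⋆ P ⊕ E ⋆ cst (ℕ→ℚ 2)   ≈⟨ S.+-congˡ {∂ E ⋆ P} (S.*-congˡ {E} ∂-1+2X) ⟨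
        ∂ E ⋆ P ⊕ E ⋆ ∂ P           ≈⟨ ∂-⋆ E P ⟨
        ∂ (E ⋆ P)                   ≈⟨ ∂-cong [1+2X]⁻¹-inverse ⟩
        ∂ 1ₛ                        ≈⟨ ∂-cst 1ℚ ⟩
        0ₛ                          ∎

  ∂G-identity : ∂ G ⋆ (1+2X ⋆ 1+2X ⋆ y) ≋ Rt C
  ∂G-identity = begin
    ∂ ((H ⋆ y) ⋆ E) ⋆ (P ⋆ P ⋆ y)
      ≈⟨ S.*-congʳ {P ⋆ P ⋆ y} (S.trans (∂-⋆ (H ⋆ y) E) (S.+-congʳ {(H ⋆ y) ⋆ ∂ E} (S.*-congʳ {E} (∂-⋆ H y)))) ⟩
    ((∂ H ⋆ y ⊕ H ⋆ ∂ y) ⋆ E ⊕ (H ⋆ y) ⋆ ∂ E) ⋆ (P ⋆ P ⋆ y)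
      ≈⟨ solve 7 (λ dh h y dy e de p →
                    ((dh :* y :+ h :* dy) :* e :+ (h :* y) :* de) :* (p :* p :* y)
                 := dh :* (y :* y) :* (e :* p) :* p :+ h :* (y :* dy) :* (e :* p) :* p :+ h :* (y :* y) :* (de :* (p :* p)))
               S.refl (∂ H) H y (∂ y) E (∂ E) P ⟩
    ∂ H ⋆ (y ⋆ y) ⋆ (E ⋆ P) ⋆ P ⊕ H ⋆ (y ⋆ ∂ y) ⋆ (E ⋆ P) ⋆ P ⊕ H ⋆ (y ⋆ y) ⋆ (∂ E ⋆ (P ⋆ P))
      ≈⟨ S.+-cong (S.+-cong (S.*-congʳ {P} (S.*-cong (S.*-congˡ {∂ H} y⋆y≋Q) [1+2X]⁻¹-inverse))
                            (S.*-congʳ {P} (S.*-cong (S.*-congˡ {H} y⋆∂y≋) [1+2X]⁻¹-inverse)))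
                  (S.*-cong (S.*-congˡ {H} y⋆y≋Q) ∂E⋆P⋆P≋) ⟩
    ∂ H ⋆ Qser ⋆ 1ₛ ⋆ P ⊕ H ⋆ (u ⋆ P) ⋆ 1ₛ ⋆ P ⊕ H ⋆ Qser ⋆ cst (- ℕ→ℚ 2)
      ≈⟨ solve 3 (λ dh h x →
           let p = con (ℕ→ℚ 1) :+ con (ℕ→ℚ 2) :* x
               u = x :+ x :* x
               q = con (ℕ→ℚ 4) :+ u :* u
               horner : List ℚ → Polynomial 3
               horner = foldr (λ a r → con a :+ x :* r) (con 0ℚ)
           in dh :* q :* con 1ℚ :* p :+ h :* (u :* p) :* con 1ℚ :* p :+ h :* q :* con (- ℕ→ℚ 2)
              := horner P-∂H :* dh :+ horner P-H :* h)
               S.refl (∂ H) H X ⟩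
    poly P-∂H ⋆ ∂ H ⊕ poly P-H ⋆ H
      ≈⟨ ode ⟩
    Rt C ∎
    where open import Data.List using (List; foldr)

module OddPrime (k : ℕ) (p-prime : Prime (3 ℕ.+ (k ℕ.+ k))) where
  open RationalEmbedding
  open PowerSeries
  open Curve
  open import Data.Nat as ℕ using (zero; suc; _≤_; _<_; _∸_; s≤s)
  import Data.Nat.Properties as ℕ
  open import Data.Nat.Divisibility as ℕ∣ using (_∣_)
  open import Data.Nat.Induction using (<-rec)
  import Data.Nat.Tactic.RingSolver as ℕ-Solver
  open import Data.Integer as ℤ using ()
  import Data.Integer.Divisibility.Signed as ℤ∣
  open import Data.Rational hiding (_≤_; _<_; ∣_∣)
  open import Data.Rational.Properties
  open import Relation.Nullary using (¬_; Dec; yes; no)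
  open import Relation.Binary.PropositionalEquality

  p : ℕ
  p = 3 ℕ.+ (k ℕ.+ k)

  open Integrality p p-prime
  open SeriesIntegrality p p-prime
  open CurveIntegrality p p-prime

  p∤2 : ¬ p ∣ 2
  p∤2 p∣2 with ℕ∣.∣⇒≤ p∣2
  ... | s≤s (s≤s ())

  p∤2^ : ∀ n → ¬ p ∣ 2 ℕ.^ n
  p∤2^ zero    = p∤1
  p∤2^ (suc n) = p∤* p∤2 (p∤2^ n)

  Integral-¼ : Integral (ℤ.+ 1 / 4)
  Integral-¼ = integral (fraction 4 (ℤ.+ 1) refl) (p∤* {2} {2} p∤2 p∤2)

  module Exactness (C : ℕ → ℚ) (recurrence : ∀ n → Recurrence C n)
                   (y : Series) (y₀≡2 : y 0 ≡ ℕ→ℚ 2) (y⋆y≡Q : ∀ n → (y ⋆ y) n ≡ Qser n)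
                   (g : Series) (g⋆Den≡Rt : ∀ n → (g ⋆ Den y) n ≡ Rt C n)
                   (C-int : ∀ n → n ≤ 3 ℕ.* p → PIntegral p (C n)) (g-int : PIntegralSeries p g) where
    open RecurrenceAsODE C recurrence using (H)
    open Primitive C recurrence y y⋆y≡Q using (G; ∂G-identity)
    open import Relation.Binary.Reasoning.Setoid S.setoid
    open SeriesSolver

    y⋆y≋Q : y ⋆ y ≋ Qser
    y⋆y≋Q = pointwise y⋆y≡Q

    y-int : IntegralSeries y
    y-int = IntegralSeries-sqrt y⋆y≋Q IntegralSeries-Qser (subst Integral (sym y₀≡2) (Integral-ℕ 2)) Integral-¼
              (cong (λ t → ℤ.+ 1 / 4 * (t + t)) y₀≡2)

    G-int : ∀ m → m < 3 ℕ.* p → Integral (G m)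
    G-int m m<3p = IntegralUpTo-⋆ m (IntegralUpTo-⋆ m H-int (IntegralSeries⇒IntegralUpTo m y-int))
                                    (IntegralSeries⇒IntegralUpTo m IntegralSeries-[1+2X]⁻¹) m ℕ.≤-refl
      where
      H-int : IntegralUpTo m H
      H-int j j≤m = PIntegral⇒Integral {C (suc j)} (C-int (suc j) (ℕ.≤-trans (s≤s j≤m) m<3p))

    2g≋∂G : cst (ℕ→ℚ 2) ⋆ g ≋ ∂ G
    2g≋∂G = ⋆-cancelʳ {d = 1+2X ⋆ 1+2X ⋆ y} {e = ½} ½d₀≡1 (begin
      (cst (ℕ→ℚ 2) ⋆ g) ⋆ (1+2X ⋆ 1+2X ⋆ y)
        ≈⟨ solve 4 (λ c g P y → (c :* g) :* (P :* P :* y) := g :* (c :* P :* P :* y))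
                 S.refl (cst (ℕ→ℚ 2)) g 1+2X y ⟩
      g ⋆ Den y                ≈⟨ pointwise g⋆Den≡Rt ⟩
      Rt C                     ≈⟨ ∂G-identity ⟨
      ∂ G ⋆ (1+2X ⋆ 1+2X ⋆ y)  ∎)
      where
      ½d₀≡1 : ½ * (1+2X ⋆ 1+2X ⋆ y) 0 ≡ 1ℚ
      ½d₀≡1 = cong (λ t → ½ * ((1+2X ⋆ 1+2X) 0 * t)) y₀≡2

    g-vanishing-below-3p : ∀ n → suc n < 3 ℕ.* p → p ∣ suc n → Vanishing (g n)
    g-vanishing-below-3p n 1+n<3p p∣1+n = Vanishing-cancelˡ p∤2 (subst Vanishing 2gₙ≡ [n+1]Gₙ₊₁-vanishes)
      where
      [n+1]Gₙ₊₁-vanishes : Vanishing (ℕ→ℚ (suc n) * G (suc n))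
      [n+1]Gₙ₊₁-vanishes = Vanishing-*ʳ (Vanishing-ℤ {ℤ.+ suc n} (ℤ∣.∣ᵤ⇒∣ p∣1+n)) (G-int (suc n) 1+n<3p)
      2gₙ≡ : ℕ→ℚ (suc n) * G (suc n) ≡ ℕ→ℚ 2 * g n
      2gₙ≡ = sym (trans (sym (cst-⋆ (ℕ→ℚ 2) g n)) (at 2g≋∂G n))

    T : Series
    T = 1+2X ⋆ y

    T-int : IntegralSeries T
    T-int = IntegralSeries-⋆ IntegralSeries-1+2X y-int

    T^-constant : ∀ n → (T ^ n) 0 ≡ ℕ→ℚ (2 ℕ.^ n)
    T^-constant zero    = refl
    T^-constant (suc n) = trans (cong₂ (λ a b → (1+2X 0 * a) * b) y₀≡2 (T^-constant n))
                                (sym (ℕ→ℚ-homo-* 2 (2 ℕ.^ n)))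

    A : Series
    A = cst ½ ⋆ Rt C ⋆ (1+2X ^ (1 ℕ.+ (k ℕ.+ k)) ⋆ Qser ^ suc k)

    g⋆Tᵖ≋A : g ⋆ T ^ p ≋ A
    g⋆Tᵖ≋A = begin
      g ⋆ (1+2X ⋆ y) ^ p
        ≈⟨ S.*-congˡ {g} (^-distrib-* 1+2X y p) ⟩
      g ⋆ (1+2X ^ (2 ℕ.+ m) ⋆ (y ⋆ y ^ suc (suc (k ℕ.+ k))))
        ≈⟨ S.*-congˡ {g} (S.*-cong (^-homo-* 1+2X 2 m) (S.*-congˡ {y} y^[2+2k]≋Qᵏ⁺¹)) ⟩
      g ⋆ ((1+2X ⋆ (1+2X ⋆ 1ₛ) ⋆ 1+2X ^ m) ⋆ (y ⋆ Qser ^ suc k))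
        ≈⟨ solve 5 (λ g P y Pᵐ Qʲ → g :* ((P :* (P :* con 1ℚ) :* Pᵐ) :* (y :* Qʲ))
                                    := con ½ :* (g :* (con (ℕ→ℚ 2) :* P :* P :* y)) :* (Pᵐ :* Qʲ))
                 S.refl g 1+2X y (1+2X ^ m) (Qser ^ suc k) ⟩
      cst ½ ⋆ (g ⋆ Den y) ⋆ (1+2X ^ m ⋆ Qser ^ suc k)
        ≈⟨ S.*-congʳ {1+2X ^ m ⋆ Qser ^ suc k} (S.*-congˡ {cst ½} (pointwise g⋆Den≡Rt)) ⟩
      A ∎
      where
      m : ℕ
      m = 1 ℕ.+ (k ℕ.+ k)
      y^[2+2k]≋Qᵏ⁺¹ : y ^ suc (suc (k ℕ.+ k)) ≋ Qser ^ suc k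
      y^[2+2k]≋Qᵏ⁺¹ = begin
        y ^ suc (suc (k ℕ.+ k))     ≈⟨ ^-congʳ y (cong suc (sym (ℕ.+-suc k k))) ⟩
        y ^ (suc k ℕ.+ suc k)       ≈⟨ ^-homo-* y (suc k) (suc k) ⟩
        y ^ suc k ⋆ y ^ suc k       ≈⟨ ^-distrib-* y y (suc k) ⟨
        (y ⋆ y) ^ suc k             ≈⟨ ^-congˡ (suc k) y⋆y≋Q ⟩
        Qser ^ suc k                ∎

    A-vanishes : ∀ n → 3 ℕ.* p ≤ suc n → A n ≡ 0ℚ
    A-vanishes n 3p≤1+n = Deg≤-A n (ℕ.≤-pred (subst (_≤ suc n) 3p≡2+d 3p≤1+n))
      where
      d : ℕ
      d = (0 ℕ.+ 2) ℕ.+ ((1 ℕ.+ (k ℕ.+ k)) ℕ.* 1 ℕ.+ suc k ℕ.* 4)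
      Deg≤-A : Deg≤ A d
      Deg≤-A = Deg≤-⋆ (Deg≤-⋆ (Deg≤-cst {d = 0}) (Deg≤-Rt C))
                      (Deg≤-⋆ (Deg≤-^ (1 ℕ.+ (k ℕ.+ k)) Deg≤-1+2X) (Deg≤-^ (suc k) Deg≤-Qser))
      3p≡2+d : 3 ℕ.* p ≡ suc (suc d)
      3p≡2+d = arithmetic k
        where
        arithmetic : ∀ k → 3 ℕ.* (3 ℕ.+ (k ℕ.+ k))
                         ≡ suc (suc ((0 ℕ.+ 2) ℕ.+ ((1 ℕ.+ (k ℕ.+ k)) ℕ.* 1 ℕ.+ suc k ℕ.* 4)))
        arithmetic = ℕ-Solver.solve-∀

    -- In (g ⋆ Tᵖ)ₙ = Aₙ = 0 the terms with p ∤ n − i vanish mod p by ^p-vanishing, those with i < n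
    -- by induction, which leaves gₙ (Tᵖ)₀ = gₙ 2ᵖ.
    g-vanishing-beyond-3p : ∀ n → 3 ℕ.* p ≤ suc n → (∀ {m} → m < n → p ∣ suc m → Vanishing (g m)) →
                            p ∣ suc n → Vanishing (g n)
    g-vanishing-beyond-3p n 3p≤1+n below-n p∣1+n =
      Vanishing-cancelˡ (p∤2^ p) (subst Vanishing (*-comm (g n) (ℕ→ℚ (2 ℕ.^ p))) leading-term)
      where
      others : ∀ i → i ≤ n → ¬ i ≡ n → Vanishing (g i * (T ^ p) (n ∸ i))
      others i i≤n i≢n = by-divisibility (p ℕ∣.∣? (n ∸ i))
        where
        by-divisibility : Dec (p ∣ n ∸ i) → Vanishing (g i * (T ^ p) (n ∸ i))
        by-divisibility (yes p∣n-i) =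
          Vanishing-*ʳ (below-n (ℕ.≤∧≢⇒< i≤n i≢n) p∣1+i) (coeff (IntegralSeries-^ p T-int) (n ∸ i))
          where
          1+n≡[n-i]+[1+i] : suc n ≡ (n ∸ i) ℕ.+ suc i
          1+n≡[n-i]+[1+i] = trans (cong suc (sym (ℕ.m∸n+n≡m i≤n))) (sym (ℕ.+-suc (n ∸ i) i))
          p∣1+i : p ∣ suc i
          p∣1+i = ℕ∣.∣m+n∣m⇒∣n (subst (p ∣_) 1+n≡[n-i]+[1+i] p∣1+n) p∣n-i
        by-divisibility (no p∤n-i) =
          Vanishing-*ˡ (PIntegral⇒Integral {g i} (g-int i)) (^p-vanishing T-int (n ∸ i) p∤n-i)
      sum-vanishes : Vanishing ((g ⋆ T ^ p) n)
      sum-vanishes = subst Vanishing (sym (trans (at g⋆Tᵖ≋A n) (A-vanishes n 3p≤1+n))) Vanishing-0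
      leading-term : Vanishing (g n * ℕ→ℚ (2 ℕ.^ p))
      leading-term = subst Vanishing (trans (cong (λ m → g n * (T ^ p) m) (ℕ.n∸n≡0 n))
                                            (cong (g n *_) (T^-constant p)))
                       (vanishing-term n n ℕ.≤-refl others sum-vanishes)

    g-vanishing : ∀ n → p ∣ suc n → Vanishing (g n)
    g-vanishing = <-rec (λ n → p ∣ suc n → Vanishing (g n)) step
      where
      step : ∀ n → (∀ {m} → m < n → p ∣ suc m → Vanishing (g m)) → p ∣ suc n → Vanishing (g n)
      step n below-n p∣1+n = by-size (suc n ℕ.<? 3 ℕ.* p)
        where
        by-size : Dec (suc n < 3 ℕ.* p) → Vanishing (g n)
        by-size (yes 1+n<3p) = g-vanishing-below-3p n 1+n<3p p∣1+n
        by-size (no  1+n≮3p) = g-vanishing-beyond-3p n (ℕ.≮⇒≥ 1+n≮3p) below-n p∣1+n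

    exactness : ExactModP p g
    exactness = exactness-criterion g-int g-vanishing

module EvenPrime where
  open RationalEmbedding
  open PowerSeries hiding (_^_)
  open Curve
  open import Data.Nat as ℕ using (zero; suc; _≤_; _<_; _∸_; _^_; z≤n; s≤s)
  import Data.Nat.Properties as ℕ
  open import Data.Nat.Divisibility as ℕ∣ using (_∣_; divides)
  open import Data.Nat.Primality using (prime[2])
  open import Data.Integer as ℤ using (ℤ; ∣_∣)
  import Data.Integer.Properties as ℤ
  import Data.Integer.Divisibility.Signed as ℤ∣
  open import Data.Rational hiding (_≤_; _<_; ∣_∣)
  open import Data.Rational.Properties
  open import Data.Product using (∃; _×_; _,_; proj₁; proj₂)
  open import Data.Empty using (⊥-elim)
  open import Relation.Nullary using (¬_; yes; no)
  open import Relation.Binary.PropositionalEquality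
  import Tactic.RingSolver as Solver

  open Integrality 2 prime[2]
  open SeriesIntegrality 2 prime[2]
  open CurveIntegrality 2 prime[2] using (IntegralSeries-1+2X)

  Integral-half : ∀ {x} → Vanishing x → Integral (½ * x)
  Integral-half {x} (vanishing (integral (fraction d i x*d≡i) 2∤d) (ℤ∣.divides j i≡j*2)) =
    integral (fraction d j (begin
      ½ * x * ℕ→ℚ d              ≡⟨ *-assoc ½ x (ℕ→ℚ d) ⟩
      ½ * (x * ℕ→ℚ d)            ≡⟨ cong (λ t → ½ * t) (trans x*d≡i (trans (cong ℤ→ℚ i≡j*2) (ℤ→ℚ-homo-* j (ℤ.+ 2)))) ⟩
      ½ * (ℤ→ℚ j * ℕ→ℚ 2)        ≡⟨ halve (ℤ→ℚ j) ⟩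
      ℤ→ℚ j                      ∎)) 2∤d
    where
    open ≡-Reasoning
    halve : ∀ a → ½ * (a * ℕ→ℚ 2) ≡ a
    halve = Solver.solve-∀ ℚ-ring

  n<2^n : ∀ n → n < 2 ^ n
  n<2^n zero    = s≤s z≤n
  n<2^n (suc n) = ℕ.≤-trans (s≤s (n<2^n n))
    (subst (suc (2 ^ n) ≤_) (cong (2 ^ n ℕ.+_) (sym (ℕ.+-identityʳ (2 ^ n))))
           (ℕ.+-monoˡ-≤ (2 ^ n) (ℕ.m^n>0 2 n)))

  2^∣*odd⇒2^∣ : ∀ t {m d} → ¬ 2 ∣ d → 2 ^ t ∣ m ℕ.* d → 2 ^ t ∣ m
  2^∣*odd⇒2^∣ zero    {m}     _    _ = ℕ∣.1∣ m
  2^∣*odd⇒2^∣ (suc t) {m} {d} 2∤d 2^[1+t]∣md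
    with p∣*-cancelʳ {m} {d} (ℕ∣.∣-trans (ℕ∣.m∣m*n (2 ^ t)) 2^[1+t]∣md) 2∤d
  ... | divides m′ refl = subst (2 ℕ.* 2 ^ t ∣_) (ℕ.*-comm 2 m′)
    (ℕ∣.*-monoʳ-∣ 2 (2^∣*odd⇒2^∣ t {m′} {d} 2∤d (ℕ∣.*-cancelˡ-∣ {2 ^ t} {m′ ℕ.* d} 2
      (subst (2 ℕ.* 2 ^ t ∣_) (trans (cong (ℕ._* d) (ℕ.*-comm m′ 2)) (ℕ.*-assoc 2 m′ d))
             2^[1+t]∣md))))

  2^-divides-numerator : ∀ {x z} t → Integral z → x ≡ ℕ→ℚ (2 ^ t) * z → 2 ^ t ∣ ∣ ↥ x ∣
  2^-divides-numerator {x} {z} t (integral (fraction d i z*d≡i) 2∤d) x≡2ᵗz =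
    2^∣*odd⇒2^∣ t 2∤d (subst (2 ^ t ∣_) (sym (∣numer∣-agree (reduced x) x-fraction)) 2ᵗ∣2ᵗi↧x)
    where
    open ≡-Reasoning
    x-fraction : Fraction x
    x-fraction = fraction d (ℤ.+ (2 ^ t) ℤ.* i) (begin
      x * ℕ→ℚ d                   ≡⟨ cong (_* ℕ→ℚ d) x≡2ᵗz ⟩
      ℕ→ℚ (2 ^ t) * z * ℕ→ℚ d     ≡⟨ *-assoc (ℕ→ℚ (2 ^ t)) z (ℕ→ℚ d) ⟩
      ℕ→ℚ (2 ^ t) * (z * ℕ→ℚ d)   ≡⟨ cong (ℕ→ℚ (2 ^ t) *_) z*d≡i ⟩
      ℕ→ℚ (2 ^ t) * ℤ→ℚ i         ≡⟨ ℤ→ℚ-homo-* (ℤ.+ (2 ^ t)) i ⟨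
      ℤ→ℚ (ℤ.+ (2 ^ t) ℤ.* i)     ∎)
    2ᵗ∣2ᵗi↧x : 2 ^ t ∣ ∣ ℤ.+ (2 ^ t) ℤ.* i ∣ ℕ.* ↧ₙ x
    2ᵗ∣2ᵗi↧x = subst (λ m → 2 ^ t ∣ m ℕ.* ↧ₙ x) (sym (ℤ.abs-* (ℤ.+ (2 ^ t)) i))
                 (ℕ∣.∣-trans (ℕ∣.m∣m*n ∣ i ∣) (ℕ∣.m∣m*n (↧ₙ x)))

  -- Use the power of 2 exceeding the numerator.
  infinitely-divisible⇒0 : ∀ x → (∀ t → ∃ λ z → Integral z × x ≡ ℕ→ℚ (2 ^ t) * z) → x ≡ 0ℚ
  infinitely-divisible⇒0 x divisible with ℕ._≟_ ∣ ↥ x ∣ 0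
  ... | yes ∣↥x∣≡0 = ↥p≡0⇒p≡0 x (ℤ.∣i∣≡0⇒i≡0 ∣↥x∣≡0)
  ... | no  ∣↥x∣≢0 = ⊥-elim (ℕ.<⇒≱ (n<2^n ∣ ↥ x ∣) (ℕ∣.∣⇒≤ {{ℕ.≢-nonZero ∣↥x∣≢0}}
      (2^-divides-numerator ∣ ↥ x ∣ (proj₁ (proj₂ (divisible ∣ ↥ x ∣))) (proj₂ (proj₂ (divisible ∣ ↥ x ∣))))))

  2ⁿ*a≡0⇒a≡0 : ∀ n {a} → ℕ→ℚ (2 ^ n) * a ≡ 0ℚ → a ≡ 0ℚ
  2ⁿ*a≡0⇒a≡0 zero    {a} a≡0   = trans (sym (*-identityˡ a)) a≡0
  2ⁿ*a≡0⇒a≡0 (suc n) {a} 2ⁿ⁺¹a≡0 = 2ⁿ*a≡0⇒a≡0 n (begin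
    ℕ→ℚ (2 ^ n) * a                        ≡⟨ halve (ℕ→ℚ (2 ^ n) * a) ⟨
    ½ * (ℕ→ℚ 2 * (ℕ→ℚ (2 ^ n) * a))        ≡⟨ cong (λ t → ½ * t) (*-assoc (ℕ→ℚ 2) (ℕ→ℚ (2 ^ n)) a) ⟨
    ½ * (ℕ→ℚ 2 * ℕ→ℚ (2 ^ n) * a)          ≡⟨ cong (λ t → ½ * (t * a)) (ℕ→ℚ-homo-* 2 (2 ^ n)) ⟨
    ½ * (ℕ→ℚ (2 ^ suc n) * a)              ≡⟨ cong (λ t → ½ * t) 2ⁿ⁺¹a≡0 ⟩
    ½ * 0ℚ                                 ≡⟨ *-zeroʳ ½ ⟩
    0ℚ                                     ∎)
    where
    open ≡-Reasoning
    halve : ∀ b → ½ * (ℕ→ℚ 2 * b) ≡ b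
    halve = Solver.solve-∀ ℚ-ring

  scale : Series → Series
  scale f n = ℕ→ℚ (2 ^ n) * f n

  scale-cong : ∀ {f g} → f ≋ g → scale f ≋ scale g
  scale-cong f≋g = pointwise λ n → cong (ℕ→ℚ (2 ^ n) *_) (at f≋g n)

  scale-⊕ : ∀ f g → scale (f ⊕ g) ≋ scale f ⊕ scale g
  scale-⊕ f g = pointwise λ n → *-distribˡ-+ (ℕ→ℚ (2 ^ n)) (f n) (g n)

  scale-⋆ : ∀ f g → scale (f ⋆ g) ≋ scale f ⋆ scale g
  scale-⋆ f g = pointwise λ n → trans (sumTo-*ˡ n (ℕ→ℚ (2 ^ n)) (λ i → f i * g (n ∸ i))) (sumTo-cong n (λ i i≤n →
    trans (cong (_* (f i * g (n ∸ i))) (split n i i≤n))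
          (regroup (ℕ→ℚ (2 ^ i)) (ℕ→ℚ (2 ^ (n ∸ i))) (f i) (g (n ∸ i)))))
    where
    open FiniteSums
    split : ∀ n i → i ≤ n → ℕ→ℚ (2 ^ n) ≡ ℕ→ℚ (2 ^ i) * ℕ→ℚ (2 ^ (n ∸ i))
    split n i i≤n = trans (cong (λ m → ℕ→ℚ (2 ^ m)) (sym (ℕ.m+[n∸m]≡n i≤n)))
                          (trans (cong ℕ→ℚ (ℕ.^-distribˡ-+-* 2 i (n ∸ i))) (ℕ→ℚ-homo-* (2 ^ i) (2 ^ (n ∸ i))))
    regroup : ∀ a b c d → (a * b) * (c * d) ≡ (a * c) * (b * d)
    regroup = Solver.solve-∀ ℚ-ring

  scale-cst : ∀ a → scale (cst a) ≋ cst a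
  scale-cst a = pointwise λ { zero → *-identityˡ a ; (suc n) → *-zeroʳ (ℕ→ℚ (2 ^ suc n)) }

  scale-X : scale X ≋ cst (ℕ→ℚ 2) ⋆ X
  scale-X = pointwise λ n → trans (coefficients n) (sym (cst-⋆ (ℕ→ℚ 2) X n))
    where
    coefficients : ∀ n → scale X n ≡ ℕ→ℚ 2 * X n
    coefficients zero          = refl
    coefficients (suc zero)    = refl
    coefficients (suc (suc n)) = trans (*-zeroʳ (ℕ→ℚ (2 ^ suc (suc n)))) (sym (*-zeroʳ (ℕ→ℚ 2)))

  -- Q(2x) = 4 q(x)
  q : Series
  q = 1ₛ ⊕ X ⋆ X ⊕ cst (ℕ→ℚ 4) ⋆ (X ⋆ X ⋆ X) ⊕ cst (ℕ→ℚ 4) ⋆ (X ⋆ X ⋆ X ⋆ X)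

  scale-Qser : scale Qser ≋ cst (ℕ→ℚ 4) ⋆ q
  scale-Qser = begin
    scale (cst (ℕ→ℚ 4) ⊕ u ⋆ u)                  ≈⟨ scale-⊕ (cst (ℕ→ℚ 4)) (u ⋆ u) ⟩
    scale (cst (ℕ→ℚ 4)) ⊕ scale (u ⋆ u)          ≈⟨ S.+-cong (scale-cst (ℕ→ℚ 4)) (scale-⋆ u u) ⟩
    cst (ℕ→ℚ 4) ⊕ scale u ⋆ scale u              ≈⟨ S.+-congˡ {cst (ℕ→ℚ 4)} (S.*-cong scale-u scale-u) ⟩
    cst (ℕ→ℚ 4) ⊕ (2X ⊕ 2X ⋆ 2X) ⋆ (2X ⊕ 2X ⋆ 2X)
      ≈⟨ solve 1 (λ x → let y = con (ℕ→ℚ 2) :* x in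
                        con (ℕ→ℚ 4) :+ (y :+ y :* y) :* (y :+ y :* y)
                        := con (ℕ→ℚ 4) :* (con 1ℚ :+ x :* x :+ con (ℕ→ℚ 4) :* (x :* x :* x)
                                                    :+ con (ℕ→ℚ 4) :* (x :* x :* x :* x)))
               S.refl X ⟩
    cst (ℕ→ℚ 4) ⋆ q                              ∎
    where
    open import Relation.Binary.Reasoning.Setoid S.setoid
    open SeriesSolver
    u 2X : Series
    u = X ⊕ X ⋆ X
    2X = cst (ℕ→ℚ 2) ⋆ X
    scale-u : scale u ≋ 2X ⊕ 2X ⋆ 2X
    scale-u = S.trans (scale-⊕ X (X ⋆ X)) (S.+-cong scale-X (S.trans (scale-⋆ X X) (S.*-cong scale-X scale-X)))

  IntegralSeries-scale : ∀ {f} → IntegralSeries f → IntegralSeries (scale f)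
  IntegralSeries-scale f-int = integralSeries λ n → Integral-* (Integral-ℕ (2 ^ n)) (coeff f-int n)

  IntegralSeries-q : IntegralSeries q
  IntegralSeries-q = IntegralSeries-⊕ (IntegralSeries-⊕ (IntegralSeries-⊕ (IntegralSeries-cst (Integral-ℕ 1)) X²)
                                                          (IntegralSeries-⋆ 4-int X³))
                                      (IntegralSeries-⋆ 4-int (IntegralSeries-⋆ X³ IntegralSeries-X))
    where
    4-int : IntegralSeries (cst (ℕ→ℚ 4))
    4-int = IntegralSeries-cst (Integral-ℕ 4)
    X² : IntegralSeries (X ⋆ X)
    X² = IntegralSeries-⋆ IntegralSeries-X IntegralSeries-X
    X³ : IntegralSeries (X ⋆ X ⋆ X)
    X³ = IntegralSeries-⋆ X² IntegralSeries-X

  record Solution (κ σ : Series) : Set where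
    constructor solution
    field
      κ-integral : IntegralSeries κ
      σ-integral : IntegralSeries σ
      equation   : σ ⋆ σ ≋ κ ⋆ κ ⋆ q

  -- Since q ≡ (1 + x)² (mod 2), δ = σ − κ (1 + x) has δ² ≡ 0, hence δ ≡ 0 (mod 2). Writing σ = 2τ + κ (1 + x),
  -- q − (1 + x)² = −2x + 4x³ + 4x⁴ turns the equation into x κ² ≡ 0 (mod 2), hence κ ≡ 0 and σ ≡ 0.
  solution-vanishes : ∀ {κ σ} → Solution κ σ → (∀ n → Vanishing (κ n)) × (∀ n → Vanishing (σ n))
  solution-vanishes {κ} {σ} (solution κ-int σ-int σ²≋κ²q) = κ-vanishes , σ-vanishes
    where
    open import Relation.Binary.Reasoning.Setoid S.setoid
    open SeriesSolver
    P δ τ S₁ S₂ D : Series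
    P = 1ₛ ⊕ X
    δ = σ ⊕ -ₛ (κ ⋆ P)
    τ = cst ½ ⋆ δ
    S₁ = κ ⋆ κ ⋆ (1ₛ ⊕ X ⊕ X ⋆ X ⊕ cst (ℕ→ℚ 2) ⋆ (X ⋆ X ⋆ X) ⊕ cst (ℕ→ℚ 2) ⋆ (X ⋆ X ⋆ X ⋆ X)) ⊕ -ₛ (σ ⋆ κ ⋆ P)
    S₂ = κ ⋆ κ ⋆ (X ⋆ X ⋆ X ⋆ P) ⊕ -ₛ (τ ⋆ τ) ⊕ -ₛ (τ ⋆ κ ⋆ P)

    D = σ ⋆ σ ⊕ -ₛ (κ ⋆ κ ⋆ q)

    D≋0 : D ≋ 0ₛ
    D≋0 = S.trans (S.+-congʳ σ²≋κ²q) (S.-‿inverseʳ (κ ⋆ κ ⋆ q))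

    δ²≋2S₁ : δ ⋆ δ ≋ cst (ℕ→ℚ 2) ⋆ S₁
    δ²≋2S₁ = begin
      δ ⋆ δ
        ≈⟨ solve 3 (λ s k x →
             let P = con 1ℚ :+ x
                 q = con 1ℚ :+ x :* x :+ con (ℕ→ℚ 4) :* (x :* x :* x) :+ con (ℕ→ℚ 4) :* (x :* x :* x :* x)
                 S₁ = k :* k :* (con 1ℚ :+ x :+ x :* x :+ con (ℕ→ℚ 2) :* (x :* x :* x) :+ con (ℕ→ℚ 2) :* (x :* x :* x :* x))
                      :- s :* k :* P
             in (s :- k :* P) :* (s :- k :* P) := con (ℕ→ℚ 2) :* S₁ :+ (s :* s :- k :* k :* q))
             S.refl σ κ X ⟩
      cst (ℕ→ℚ 2) ⋆ S₁ ⊕ D     ≈⟨ S.+-congˡ {cst (ℕ→ℚ 2) ⋆ S₁} D≋0 ⟩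
      cst (ℕ→ℚ 2) ⋆ S₁ ⊕ 0ₛ    ≈⟨ S.+-identityʳ _ ⟩
      cst (ℕ→ℚ 2) ⋆ S₁         ∎

    Xκ²≋2S₂ : X ⋆ (κ ⋆ κ) ≋ cst (ℕ→ℚ 2) ⋆ S₂
    Xκ²≋2S₂ = begin
      X ⋆ (κ ⋆ κ)
        ≈⟨ solve 3 (λ s k x →
             let P = con 1ℚ :+ x
                 q = con 1ℚ :+ x :* x :+ con (ℕ→ℚ 4) :* (x :* x :* x) :+ con (ℕ→ℚ 4) :* (x :* x :* x :* x)
                 t = con ½ :* (s :- k :* P)
                 S₂ = k :* k :* (x :* x :* x :* P) :- t :* t :- t :* k :* P
             in x :* (k :* k) := con (ℕ→ℚ 2) :* S₂ :+ con ½ :* (s :* s :- k :* k :* q))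
             S.refl σ κ X ⟩
      cst (ℕ→ℚ 2) ⋆ S₂ ⊕ cst ½ ⋆ D     ≈⟨ S.+-congˡ {cst (ℕ→ℚ 2) ⋆ S₂} (S.trans (S.*-congˡ {cst ½} D≋0) (S.zeroʳ (cst ½))) ⟩
      cst (ℕ→ℚ 2) ⋆ S₂ ⊕ 0ₛ            ≈⟨ S.+-identityʳ _ ⟩
      cst (ℕ→ℚ 2) ⋆ S₂                 ∎

    P-int : IntegralSeries P
    P-int = IntegralSeries-⊕ (IntegralSeries-cst (Integral-ℕ 1)) IntegralSeries-X

    infixl 6 _⊕ᵢ_
    infixl 7 _⋆ᵢ_
    _⊕ᵢ_ : ∀ {f g} → IntegralSeries f → IntegralSeries g → IntegralSeries (f ⊕ g)
    _⊕ᵢ_ = IntegralSeries-⊕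
    _⋆ᵢ_ : ∀ {f g} → IntegralSeries f → IntegralSeries g → IntegralSeries (f ⋆ g)
    _⋆ᵢ_ = IntegralSeries-⋆
    X-int : IntegralSeries X
    X-int = IntegralSeries-X
    2-int : IntegralSeries (cst (ℕ→ℚ 2))
    2-int = IntegralSeries-cst (Integral-ℕ 2)

    S₁-int : IntegralSeries S₁
    S₁-int = κ-int ⋆ᵢ κ-int ⋆ᵢ (IntegralSeries-cst (Integral-ℕ 1) ⊕ᵢ X-int ⊕ᵢ X-int ⋆ᵢ X-int
                                ⊕ᵢ 2-int ⋆ᵢ (X-int ⋆ᵢ X-int ⋆ᵢ X-int) ⊕ᵢ 2-int ⋆ᵢ (X-int ⋆ᵢ X-int ⋆ᵢ X-int ⋆ᵢ X-int))
             ⊕ᵢ IntegralSeries-neg (σ-int ⋆ᵢ κ-int ⋆ᵢ P-int)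

    δ-vanishes : ∀ n → Vanishing (δ n)
    δ-vanishes = vanishing-from-squares δ-int λ i →
      subst Vanishing (sym (at δ²≋2S₁ (i ℕ.+ i))) (Vanishing-p⋆ S₁-int (i ℕ.+ i))
      where
      δ-int : IntegralSeries δ
      δ-int = IntegralSeries-⊕ σ-int (IntegralSeries-neg (IntegralSeries-⋆ κ-int P-int))

    τ-int : IntegralSeries τ
    τ-int = integralSeries λ n → subst Integral (sym (cst-⋆ ½ δ n)) (Integral-half (δ-vanishes n))

    S₂-int : IntegralSeries S₂
    S₂-int = κ-int ⋆ᵢ κ-int ⋆ᵢ (X-int ⋆ᵢ X-int ⋆ᵢ X-int ⋆ᵢ P-int) ⊕ᵢ IntegralSeries-neg (τ-int ⋆ᵢ τ-int)
             ⊕ᵢ IntegralSeries-neg (τ-int ⋆ᵢ κ-int ⋆ᵢ P-int)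

    κ-vanishes : ∀ n → Vanishing (κ n)
    κ-vanishes = vanishing-from-squares κ-int λ j →
      subst Vanishing (trans (sym (at Xκ²≋2S₂ (suc (j ℕ.+ j)))) (X-⋆-suc (κ ⋆ κ) (j ℕ.+ j)))
            (Vanishing-p⋆ S₂-int (suc (j ℕ.+ j)))

    σ≋2τ+κP : σ ≋ cst (ℕ→ℚ 2) ⋆ τ ⊕ κ ⋆ P
    σ≋2τ+κP = solve 3 (λ s k x → let P = con 1ℚ :+ x in s := con (ℕ→ℚ 2) :* (con ½ :* (s :- k :* P)) :+ k :* P)
                      S.refl σ κ X

    σ-vanishes : ∀ n → Vanishing (σ n)
    σ-vanishes n = subst Vanishing (sym (at σ≋2τ+κP n))
      (Vanishing-+ (Vanishing-p⋆ τ-int n)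
                   (sumTo-Vanishing n (λ i _ → Vanishing-*ʳ (κ-vanishes i) (coeff P-int (n ∸ i)))))

  halve : ∀ {κ σ} → Solution κ σ → Solution (cst ½ ⋆ κ) (cst ½ ⋆ σ)
  halve {κ} {σ} s@(solution _ _ σ²≋κ²q) =
    solution (halved (proj₁ (solution-vanishes s))) (halved (proj₂ (solution-vanishes s))) (begin
      (cst ½ ⋆ σ) ⋆ (cst ½ ⋆ σ)
        ≈⟨ solve 2 (λ h s → (h :* s) :* (h :* s) := h :* h :* (s :* s)) S.refl (cst ½) σ ⟩
      cst ½ ⋆ cst ½ ⋆ (σ ⋆ σ)
        ≈⟨ S.*-congˡ {cst ½ ⋆ cst ½} σ²≋κ²q ⟩
      cst ½ ⋆ cst ½ ⋆ (κ ⋆ κ ⋆ q)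
        ≈⟨ solve 3 (λ h k q → h :* h :* (k :* k :* q) := (h :* k) :* (h :* k) :* q) S.refl (cst ½) κ q ⟩
      (cst ½ ⋆ κ) ⋆ (cst ½ ⋆ κ) ⋆ q ∎)
    where
    open import Relation.Binary.Reasoning.Setoid S.setoid
    open SeriesSolver
    halved : ∀ {f} → (∀ n → Vanishing (f n)) → IntegralSeries (cst ½ ⋆ f)
    halved {f} f-vanishes = integralSeries λ n → subst Integral (sym (cst-⋆ ½ f n)) (Integral-half (f-vanishes n))

  divisible : ∀ t {κ σ} → Solution κ σ → ∃ λ κ′ → IntegralSeries κ′ × κ ≋ cst (ℕ→ℚ (2 ^ t)) ⋆ κ′
  divisible zero    {κ} s = κ , Solution.κ-integral s , S.sym (S.*-identityˡ κ)
  divisible (suc t) {κ} s = double (divisible t (halve s))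
    where
    open import Relation.Binary.Reasoning.Setoid S.setoid
    open SeriesSolver
    2*2ᵗ≋2ᵗ⁺¹ : cst (ℕ→ℚ 2) ⋆ cst (ℕ→ℚ (2 ^ t)) ≋ cst (ℕ→ℚ (2 ^ suc t))
    2*2ᵗ≋2ᵗ⁺¹ = S.sym (S.trans (pointwise λ n → cong (λ c → cst c n) (ℕ→ℚ-homo-* 2 (2 ^ t)))
                               (cst-* (ℕ→ℚ 2) (ℕ→ℚ (2 ^ t))))
    double : (∃ λ κ′ → IntegralSeries κ′ × cst ½ ⋆ κ ≋ cst (ℕ→ℚ (2 ^ t)) ⋆ κ′) →
             ∃ λ κ′ → IntegralSeries κ′ × κ ≋ cst (ℕ→ℚ (2 ^ suc t)) ⋆ κ′
    double (κ′ , κ′-int , ½κ≋2ᵗκ′) = κ′ , κ′-int , (begin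
      κ                                         ≈⟨ solve 1 (λ k → k := con (ℕ→ℚ 2) :* (con ½ :* k)) S.refl κ ⟩
      cst (ℕ→ℚ 2) ⋆ (cst ½ ⋆ κ)                 ≈⟨ S.*-congˡ {cst (ℕ→ℚ 2)} ½κ≋2ᵗκ′ ⟩
      cst (ℕ→ℚ 2) ⋆ (cst (ℕ→ℚ (2 ^ t)) ⋆ κ′)   ≈⟨ S.*-assoc (cst (ℕ→ℚ 2)) (cst (ℕ→ℚ (2 ^ t))) κ′ ⟨
      cst (ℕ→ℚ 2) ⋆ cst (ℕ→ℚ (2 ^ t)) ⋆ κ′     ≈⟨ S.*-congʳ {κ′} 2*2ᵗ≋2ᵗ⁺¹ ⟩
      cst (ℕ→ℚ (2 ^ suc t)) ⋆ κ′                ∎)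

  Solution⇒κ≋0 : ∀ {κ σ} → Solution κ σ → κ ≋ 0ₛ
  Solution⇒κ≋0 {κ} s = pointwise λ n → infinitely-divisible⇒0 (κ n) λ t → at-coefficient n t (divisible t s)
    where
    at-coefficient : ∀ n t → (∃ λ κ′ → IntegralSeries κ′ × κ ≋ cst (ℕ→ℚ (2 ^ t)) ⋆ κ′) →
                  ∃ λ z → Integral z × κ n ≡ ℕ→ℚ (2 ^ t) * z
    at-coefficient n t (κ′ , κ′-int , κ≋2ᵗκ′) = κ′ n , coeff κ′-int n , trans (at κ≋2ᵗκ′ n) (cst-⋆ (ℕ→ℚ (2 ^ t)) κ′ n)

  module Exactness (C : ℕ → ℚ) (y : Series) (y⋆y≡Q : ∀ n → (y ⋆ y) n ≡ Qser n)
                   (g : Series) (g⋆Den≡Rt : ∀ n → (g ⋆ Den y) n ≡ Rt C n) (g-int : PIntegralSeries 2 g) where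
    open import Relation.Binary.Reasoning.Setoid S.setoid
    open SeriesSolver

    k : Series
    k = 1+2X ⋆ 1+2X ⋆ g

    κ σ : Series
    κ = scale k
    σ = cst (ℤ.+ 1 / 4) ⋆ scale (Rt C)

    -- 4 k² Q = R̃², from 2 k y = R̃ and y² = Q
    4k²Q≋R̃² : cst (ℕ→ℚ 4) ⋆ (k ⋆ k) ⋆ Qser ≋ Rt C ⋆ Rt C
    4k²Q≋R̃² = begin
      cst (ℕ→ℚ 4) ⋆ (k ⋆ k) ⋆ Qser        ≈⟨ S.*-congˡ {cst (ℕ→ℚ 4) ⋆ (k ⋆ k)} (pointwise y⋆y≡Q) ⟨
      cst (ℕ→ℚ 4) ⋆ (k ⋆ k) ⋆ (y ⋆ y)
        ≈⟨ solve 3 (λ P g y → let k = P :* P :* g ; gD = g :* (con (ℕ→ℚ 2) :* P :* P :* y) in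
                              con (ℕ→ℚ 4) :* (k :* k) :* (y :* y) := gD :* gD)
                   S.refl 1+2X g y ⟩
      (g ⋆ Den y) ⋆ (g ⋆ Den y)           ≈⟨ S.*-cong (pointwise g⋆Den≡Rt) (pointwise g⋆Den≡Rt) ⟩
      Rt C ⋆ Rt C                         ∎

    equation : σ ⋆ σ ≋ κ ⋆ κ ⋆ q
    equation = begin
      σ ⋆ σ
        ≈⟨ solve 2 (λ c r → (c :* r) :* (c :* r) := c :* c :* (r :* r)) S.refl (cst (ℤ.+ 1 / 4)) (scale (Rt C)) ⟩
      cst ¼ ⋆ cst ¼ ⋆ (scale (Rt C) ⋆ scale (Rt C))
        ≈⟨ S.*-congˡ {cst ¼ ⋆ cst ¼} (S.trans (S.sym (scale-⋆ (Rt C) (Rt C))) (scale-cong (S.sym 4k²Q≋R̃²))) ⟩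
      cst ¼ ⋆ cst ¼ ⋆ scale (cst (ℕ→ℚ 4) ⋆ (k ⋆ k) ⋆ Qser)
        ≈⟨ S.*-congˡ {cst ¼ ⋆ cst ¼} (S.trans (scale-⋆ (cst (ℕ→ℚ 4) ⋆ (k ⋆ k)) Qser)
             (S.*-cong (S.trans (scale-⋆ (cst (ℕ→ℚ 4)) (k ⋆ k)) (S.*-cong (scale-cst (ℕ→ℚ 4)) (scale-⋆ k k))) scale-Qser)) ⟩
      cst ¼ ⋆ cst ¼ ⋆ (cst (ℕ→ℚ 4) ⋆ (κ ⋆ κ) ⋆ (cst (ℕ→ℚ 4) ⋆ q))
        ≈⟨ solve 2 (λ k q → con ¼ :* con ¼ :* (con (ℕ→ℚ 4) :* (k :* k) :* (con (ℕ→ℚ 4) :* q)) := k :* k :* q) S.refl κ q ⟩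
      κ ⋆ κ ⋆ q ∎
      where
      ¼ : ℚ
      ¼ = ℤ.+ 1 / 4

    k-int : IntegralSeries k
    k-int = IntegralSeries-⋆ (IntegralSeries-⋆ IntegralSeries-1+2X IntegralSeries-1+2X)
                             (integralSeries λ n → PIntegral⇒Integral {g n} (g-int n))

    κσ-solution : Solution κ σ
    κσ-solution = solution κ-int σ-int equation
      where
      κ-int : IntegralSeries κ
      κ-int = IntegralSeries-scale k-int
      σ≤2 : Deg≤ σ 2
      σ≤2 = Deg≤-⋆ (Deg≤-cst {d = 0}) λ n 2<n →
              trans (cong (ℕ→ℚ (2 ^ n) *_) (Deg≤-Rt C n 2<n)) (*-zeroʳ (ℕ→ℚ (2 ^ n)))
      σ-int : IntegralSeries σ
      σ-int = IntegralSeries-sqrt-quadratic σ≤2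
                (IntegralSeries-≋ (S.sym equation) (IntegralSeries-⋆ (IntegralSeries-⋆ κ-int κ-int) IntegralSeries-q))

    g≋0 : g ≋ 0ₛ
    g≋0 = ⋆-cancel-zero {g} {1+2X ⋆ 1+2X} {1ℚ} refl (S.trans (S.*-comm g (1+2X ⋆ 1+2X)) k≋0)
      where
      k≋0 : k ≋ 0ₛ
      k≋0 = pointwise λ n → 2ⁿ*a≡0⇒a≡0 n (at (Solution⇒κ≋0 κσ-solution) n)

    exactness : ExactModP 2 g
    exactness = exactness-criterion g-int (λ n _ → subst Vanishing (sym (at g≋0 n)) Vanishing-0)

module AllPrimes where
  open import Data.Nat as ℕ using (ℕ; zero; suc; _≤_)
  import Data.Nat.Properties as ℕ
  open import Data.Nat.Divisibility using (divides)
  open import Data.Nat.Primality using (Prime; prime⇒irreducible; ¬prime[1])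
  open import Data.Rational using (ℚ)
  open import Data.Product using (∃; _,_)
  open import Data.Sum using (_⊎_; inj₁; inj₂)
  open import Data.Empty using (⊥-elim)
  open import Relation.Binary.PropositionalEquality

  parity : ∀ n → ∃ λ k → n ≡ k ℕ.+ k ⊎ n ≡ suc (k ℕ.+ k)
  parity zero = 0 , inj₁ refl
  parity (suc n) with parity n
  ... | k , inj₁ n≡2k   = k , inj₂ (cong suc n≡2k)
  ... | k , inj₂ n≡2k+1 = suc k , inj₁ (trans (cong suc n≡2k+1) (cong suc (sym (ℕ.+-suc k k))))

  2k≡k*2 : ∀ k → k ℕ.+ k ≡ k ℕ.* 2
  2k≡k*2 k = trans (cong (k ℕ.+_) (sym (ℕ.+-identityʳ k))) (ℕ.*-comm 2 k)

  prime⇒2∨odd : ∀ {p} → Prime p → p ≡ 2 ⊎ ∃ λ k → p ≡ 3 ℕ.+ (k ℕ.+ k)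
  prime⇒2∨odd {p} p-prime with parity p
  ... | k , inj₁ p≡2k with prime⇒irreducible p-prime (divides k (trans p≡2k (2k≡k*2 k)))
  ...   | inj₁ ()
  ...   | inj₂ 2≡p = inj₁ (sym 2≡p)
  prime⇒2∨odd {p} p-prime | zero  , inj₂ refl   = ⊥-elim (¬prime[1] p-prime)
  prime⇒2∨odd {p} p-prime | suc k , inj₂ p≡2k+1 = inj₂ (k , trans p≡2k+1 (cong (λ m → suc (suc m)) (ℕ.+-suc k k)))

  exactness : ∀ (C : ℕ → ℚ) → (∀ n → Recurrence C n) →
              (y : Series) → y 0 ≡ ℕ→ℚ 2 → (∀ n → (y ⋆ y) n ≡ Qser n) →
              (g : Series) → (∀ n → (g ⋆ Den y) n ≡ Rt C n) →
              ∀ p → Prime p → PIntegralSeries p g → (∀ n → n ≤ 3 ℕ.* p → PIntegral p (C n)) → ExactModP p g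
  exactness C recurrence y y₀≡2 y⋆y≡Q g g⋆Den≡Rt p p-prime g-int C-int with prime⇒2∨odd p-prime
  ... | inj₁ refl       = EvenPrime.Exactness.exactness C y y⋆y≡Q g g⋆Den≡Rt g-int
  ... | inj₂ (k , refl) = OddPrime.Exactness.exactness k p-prime C recurrence y y₀≡2 y⋆y≡Q g g⋆Den≡Rt C-int g-int

open import Data.Nat using (ℕ; _≤_; _*_)
open import Data.Nat.Primality using (Prime)
open import Data.Rational using (ℚ; 0ℚ)
open import Data.Product using (_×_; ∃)
open import Relation.Nullary using (¬_)
open import Relation.Binary.PropositionalEquality using (_≡_)

open import Data.Nat using (suc; s≤s; anyUpTo?)
import Data.Nat.Properties as ℕ
open import Data.Nat.Divisibility using (_∣?_)
open import Data.Rational using (↧ₙ_)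
open import Data.Product using (_,_)
open import Data.Empty using (⊥-elim)
open import Relation.Nullary using (yes; no; ¬?)

proposition5p8 :
    (C : ℕ → ℚ) → C 0 ≡ 0ℚ → ((n : ℕ) → Recurrence C n) →
    (y : Series) → y 0 ≡ ℕ→ℚ 2 → ((n : ℕ) → (y ⋆ y) n ≡ Qser n) →
    (g : Series) → ((n : ℕ) → (g ⋆ Den y) n ≡ Rt C n) →
    ∃ λ (l : ℕ) → (p : ℕ) → Prime p →
      PIntegralSeries p g → ¬ ExactModP p g →
      ∃ λ (n : ℕ) → n ≤ l * p × ¬ PIntegral p (C n)
proposition5p8 C _ recurrence y y₀≡2 y⋆y≡Q g g⋆Den≡Rt = 3 , non-integral
  where
  non-integral : ∀ p → Prime p → PIntegralSeries p g → ¬ ExactModP p g →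
                 ∃ λ n → n ≤ 3 * p × ¬ PIntegral p (C n)
  non-integral p p-prime g-int not-exact
    with anyUpTo? (λ n → ¬? (¬? (p ∣? ↧ₙ C n))) (suc (3 * p))
  ... | yes (n , n<1+3p , n-bad) = n , ℕ.≤-pred n<1+3p , n-bad
  ... | no  none = ⊥-elim (not-exact (AllPrimes.exactness C recurrence y y₀≡2 y⋆y≡Q g g⋆Den≡Rt
                                        p p-prime g-int (λ n n≤3p p∣↧ → none (n , s≤s n≤3p , λ int → int p∣↧))))
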